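{- For all $m,n\ge 0$, \[ |\mathcal{G}_m[n]|=\sum_{k=0}^n\sum_{i=0}^k(-1)^i\binom{k}{i}\left(\!\!\binom{m(k-i)}{n}\!\!\right), \qquad |\mathcal{G}^{01}_m[n]|=\sum_{k=0}^n\sum_{i=0}^k(-1)^i\binom{k}{i}\binom{m(k-i)}{n}. \] Furthermore, for $n\ge1$ and $S=\{s_1,\dots,s_r\}\subseteq[n-1]$ with $s_1<\dots<s_r$, setting $s_0=0$ and $s_{r+1}=n$, \[ \beta^{\circ}_n(S)=\sum_{k=0}^n\sum_{i=0}^k(-1)^i\binom{k}{i}\prod_{j=0}^r\left(\!\!\binom{k-i}{s_{j+1}-s_j}\!\!\right), \qquad \beta_n(S)=\sum_{k=0}^n\sum_{i=0}^k(-1)^i\binom{k}{i}\prod_{j=0}^r\binom{k-i}{s_{j+1}-s_j}. \]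
   Context: $|\mathcal{G}_m[n]|$ is the number of matrices with $m$ rows (and any number of columns) with nonnegative integer entries summing to $n$ and no zero column; $|\mathcal{G}^{01}_m[n]|$ is the number of such matrices with entries in $\{0,1\}$. The multichoose coefficient is $\left(\!\binom{a}{b}\!\right)=\binom{a+b-1}{b}$, the number of multisets of size $b$ from an $a$-element set (so $\left(\!\binom{0}{0}\!\right)=1$ and $\left(\!\binom{0}{b}\!\right)=0$ for $b>0$). A Cayley permutation of $[n]$ is a word $w=w(1)\cdots w(n)$ of positive integers whose set of values is $\{1,\dots,k\}$ for some $k\le n$; $\mathrm{Cay}[n]$ is the set of them. Its weak ascent set is $\mathrm{Asc}(w)=\{i\in[n-1]:w(i)\le w(i+1)\}$ and strict ascent set is $\mathrm{Asc}^{\circ}(w)=\{i\in[n-1]:w(i)<w(i+1)\}$. Define $\beta_n(S)=|\{w\in\mathrm{Cay}[n]:\mathrm{Asc}(w)\subseteq S\}|$ and $\beta^{\circ}_n(S)=|\{w\in\mathrm{Cay}[n]:\mathrm{Asc}^{\circ}(w)\subseteq S\}|$. -}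

module Defs where

open import Data.Bool using (Bool; true; false; _∧_; not; if_then_else_)
open import Data.Nat using (ℕ; zero; suc; _+_; _*_; _∸_; _≡ᵇ_; _≤ᵇ_; _<ᵇ_)
open import Data.Nat.Combinatorics using (_C_)
open import Data.List using (List; []; _∷_; map; upTo; foldr)
open import Data.Bool.ListAction using (all; any)
open import Data.Nat.ListAction using (sum)
import Data.List as L
open import Data.Vec using (Vec; toList)
open import Data.Integer using (ℤ; +_; -_; 1ℤ; 0ℤ) renaming (_+_ to _+ℤ_; _*_ to _*ℤ_; _^_ to _^ℤ_)
open import Data.Product using (Σ)
open import Data.Bool using (T)

multichoose : ℕ → ℕ → ℕ
multichoose zero    zero    = 1
multichoose zero    (suc b) = 0
multichoose (suc a) b       = (a + b) C b

sumTo : ℕ → (ℕ → ℤ) → ℤ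
sumTo n f = foldr _+ℤ_ 0ℤ (L.map f (upTo (suc n)))

sign : ℕ → ℤ
sign i = (- 1ℤ) ^ℤ i

elemᵇ : ℕ → List ℕ → Bool
elemᵇ x xs = any (x ≡ᵇ_) xs

-- Matrices with m rows, represented as a list of columns (each a Vec ℕ m);
-- the number of columns is arbitrary.

colSum : ∀ {m} → Vec ℕ m → ℕ
colSum c = sum (toList c)

nonzeroColᵇ : ∀ {m} → Vec ℕ m → Bool
nonzeroColᵇ c = any (λ x → not (x ≡ᵇ 0)) (toList c)

zeroOneColᵇ : ∀ {m} → Vec ℕ m → Bool
zeroOneColᵇ c = all (λ x → x ≤ᵇ 1) (toList c)

G : ℕ → ℕ → Set
G m n = Σ (List (Vec ℕ m)) λ cols →
  T (all nonzeroColᵇ cols ∧ (sum (map colSum cols) ≡ᵇ n))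

G01 : ℕ → ℕ → Set
G01 m n = Σ (List (Vec ℕ m)) λ cols →
  T (all nonzeroColᵇ cols ∧ all zeroOneColᵇ cols ∧ (sum (map colSum cols) ≡ᵇ n))

-- Cayley permutations of [n]: a word w of length n together with k such that
-- the set of values of w is exactly {1,…,k}.

valuesAreᵇ : ∀ {n} → ℕ → Vec ℕ n → Bool
valuesAreᵇ k w =
  all (λ x → (1 ≤ᵇ x) ∧ (x ≤ᵇ k)) (toList w)
  ∧ all (λ j → elemᵇ j (toList w)) (map suc (upTo k))

Cay : ℕ → Set
Cay n = Σ ℕ λ k → Σ (Vec ℕ n) λ w → T (valuesAreᵇ k w)

-- Positions i (1-indexed, starting at index `i`) with  rel (w i) (w (i+1)).
ascPos : (ℕ → ℕ → Bool) → ℕ → List ℕ → List ℕ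
ascPos rel i []            = []
ascPos rel i (x ∷ [])      = []
ascPos rel i (x ∷ y ∷ ys)  =
  if rel x y then i ∷ ascPos rel (suc i) (y ∷ ys) else ascPos rel (suc i) (y ∷ ys)

Asc : ∀ {n} → Vec ℕ n → List ℕ
Asc w = ascPos _≤ᵇ_ 1 (toList w)

AscStrict : ∀ {n} → Vec ℕ n → List ℕ
AscStrict w = ascPos _<ᵇ_ 1 (toList w)

subsetᵇ : List ℕ → List ℕ → Bool
subsetᵇ A S = all (λ i → elemᵇ i S) A

CayAsc⊆ : (n : ℕ) → List ℕ → Set
CayAsc⊆ n S = Σ (Cay n) λ c → T (subsetᵇ (Asc (Σ.proj₁ (Σ.proj₂ c))) S)

CayAscStrict⊆ : (n : ℕ) → List ℕ → Set
CayAscStrict⊆ n S = Σ (Cay n) λ c → T (subsetᵇ (AscStrict (Σ.proj₁ (Σ.proj₂ c))) S)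

-- Subsets S = {s₁ < … < s_r} ⊆ [n-1] are represented by the strictly
-- increasing list [s₁, …, s_r] of elements of {1,…,n-1}.

strictlyIncᵇ : List ℕ → Bool
strictlyIncᵇ []           = true
strictlyIncᵇ (x ∷ [])     = true
strictlyIncᵇ (x ∷ y ∷ ys) = (x <ᵇ y) ∧ strictlyIncᵇ (y ∷ ys)

IsSubsetOfBracket : ℕ → List ℕ → Set
IsSubsetOfBracket n S =
  T (strictlyIncᵇ S ∧ all (λ s → (1 ≤ᵇ s) ∧ (s <ᵇ n)) S)

gaps : ℕ → List ℕ → ℕ → List ℕ
gaps prev []       n = (n ∸ prev) ∷ []
gaps prev (s ∷ ss) n = (s ∸ prev) ∷ gaps s ss n

prodList : List ℕ → ℕ
prodList = foldr _*_ 1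

-- Each of the four sets is the disjoint union, over k ≤ n, of the objects on exactly k labels all of
-- which are used: matrices with k columns, none of them zero, and Cayley words whose values are
-- exactly {1,…,k}.  To count these, let W k t be the objects on k labels whose first t labels are
-- used.  Splitting on whether label t+1 is used, and deleting it (and relabelling) when it is not,
-- gives W (k+1) t ≅ W (k+1) (t+1) ⊎ W k t; hence |W k k| = Σᵢ (-1)ⁱ C(k,i) |W (k-i) 0|.  Without
-- the usage constraint the count is direct: a matrix with k columns is a vector of m·k entries with
-- sum n, and a word on k values whose ascents lie in S is a concatenation of ascent-free runs of
-- lengths s_{j+1} - s_j, each counted by a multichoose or binomial coefficient.

module Submission where

module Subtypes where

  open import Data.Bool using (Bool; true; false; _∧_; not; T)
  open import Data.Bool.Properties using (T-irrelevant; ∧-assoc)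
  open import Data.Bool.ListAction using (all)
  open import Data.List using (List; []; _∷_; length; take; drop; _++_)
  open import Data.Nat using (ℕ; zero; suc; _+_; _∸_; _≤_; z≤n; s≤s; _≡ᵇ_)
  open import Data.Nat.Properties using (≡ᵇ⇒≡; ≡⇒≡ᵇ)
  open import Data.Empty using (⊥; ⊥-elim)
  open import Data.Unit using (⊤; tt)
  open import Data.Product using (Σ; _×_; _,_; proj₁; proj₂)
  open import Data.Sum using (_⊎_; inj₁; inj₂)
  open import Data.Sum.Algebra using (⊎-assoc; ⊎-comm)
  open import Data.Sum.Properties using (inj₁-injective)
  open import Data.Sum.Function.Propositional using (_⊎-↔_)
  open import Data.Fin using (Fin; zero; suc; punchIn; punchOut)
  open import Data.Fin.Properties
    using (punchInᵢ≢i; punchOut-punchIn; punchIn-punchOut; punchOut-cong; +↔⊎; 1↔⊤)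
  open import Function.Bundles using (_↔_; mk↔ₛ′; Inverse)
  open import Function.Properties.Inverse using (↔-refl; ↔-sym; ↔-trans)
  open import Relation.Binary.PropositionalEquality

  ∧-intro : ∀ {a b} → T a → T b → T (a ∧ b)
  ∧-intro {true} p q = q

  ∧-fst : ∀ {a b} → T (a ∧ b) → T a
  ∧-fst {true} _ = tt

  ∧-snd : ∀ {a b} → T (a ∧ b) → T b
  ∧-snd {true} p = p

  T⇒≡true : ∀ {a} → T a → a ≡ true
  T⇒≡true {true} _ = refl

  T-not⇒≡false : ∀ {a} → T (not a) → a ≡ false
  T-not⇒≡false {false} _ = refl

  ∧-false : ∀ {a} → T (a ∧ false) → ⊥
  ∧-false {false} ()
  ∧-false {true}  ()

  T-not-contra : ∀ {a} → T a → T (not a) → ⊥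
  T-not-contra {true} _ ()

  ¬T⇒T-not : ∀ {a} → (T a → ⊥) → T (not a)
  ¬T⇒T-not {false} _ = tt
  ¬T⇒T-not {true}  h = h tt

  _≢ᵇ_ : ℕ → ℕ → Set
  m ≢ᵇ n = T (not (m ≡ᵇ n))

  ≢⇒≢ᵇ : ∀ m n → m ≢ n → m ≢ᵇ n
  ≢⇒≢ᵇ m n ne = ¬T⇒T-not (λ p → ne (≡ᵇ⇒≡ m n p))

  ≢ᵇ⇒≢ : ∀ m n → m ≢ᵇ n → m ≢ n
  ≢ᵇ⇒≢ m n p e = T-not-contra (≡⇒≡ᵇ m n e) p

  T-subst : ∀ {a b} → a ≡ b → T a → T b
  T-subst refl p = p

  Sat : {A : Set} → (A → Bool) → Set
  Sat {A} P = Σ A λ a → T (P a)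

  Sat-≡ : {A : Set} {P : A → Bool} {a b : A} {p : T (P a)} {q : T (P b)} →
          a ≡ b → _≡_ {A = Sat P} (a , p) (b , q)
  Sat-≡ {p = p} {q} refl = cong (_ ,_) (T-irrelevant p q)

  Sat-↔ : {A B : Set} {P : A → Bool} {Q : B → Bool} (f : A → B) (g : B → A)
    → (∀ a → T (P a) → T (Q (f a))) → (∀ b → T (Q b) → T (P (g b)))
    → (∀ a → T (P a) → g (f a) ≡ a) → (∀ b → T (Q b) → f (g b) ≡ b)
    → Sat P ↔ Sat Q
  Sat-↔ f g pf qg gf fg =
    mk↔ₛ′ (λ (a , p) → f a , pf a p) (λ (b , q) → g b , qg b q)
          (λ (b , q) → Sat-≡ (fg b q)) (λ (a , p) → Sat-≡ (gf a p))

  Sat-⇔ : {A : Set} {P Q : A → Bool} →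
    (∀ a → T (P a) → T (Q a)) → (∀ a → T (Q a) → T (P a)) → Sat P ↔ Sat Q
  Sat-⇔ pq qp = Sat-↔ (λ a → a) (λ a → a) pq qp (λ _ _ → refl) (λ _ _ → refl)

  Sat-cong : {A : Set} {P Q : A → Bool} → (∀ a → P a ≡ Q a) → Sat P ↔ Sat Q
  Sat-cong e = Sat-⇔ (λ a → T-subst (e a)) (λ a → T-subst (sym (e a)))

  Sat-× : {B C : Set} (Q : B → Bool) (R : C → Bool) →
    Sat {B × C} (λ (b , c) → Q b ∧ R c) ↔ (Sat Q × Sat R)
  Sat-× Q R =
    mk↔ₛ′ (λ ((b , c) , qr) → (b , ∧-fst qr) , (c , ∧-snd {Q b} qr))
          (λ ((b , q) , (c , r)) → (b , c) , ∧-intro q r)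
          (λ _ → cong₂ _,_ (Sat-≡ refl) (Sat-≡ refl)) (λ _ → Sat-≡ refl)

  Sat-split : {A : Set} (P Q : A → Bool) →
    Sat P ↔ (Sat (λ a → P a ∧ Q a) ⊎ Sat (λ a → P a ∧ not (Q a)))
  Sat-split {A} P Q = mk↔ₛ′ to from to-from (λ (a , p) → from-to a p (Q a) refl)
    where
    Split : Set
    Split = Sat (λ a → P a ∧ Q a) ⊎ Sat (λ a → P a ∧ not (Q a))

    by : ∀ a → T (P a) → (b : Bool) → Q a ≡ b → Split
    by a p true  e = inj₁ (a , ∧-intro p (T-subst (sym e) tt))
    by a p false e = inj₂ (a , ∧-intro p (T-subst (cong not (sym e)) tt))

    to : Sat P → Split
    to (a , p) = by a p (Q a) refl

    from : Split → Sat P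
    from (inj₁ (a , pq)) = a , ∧-fst pq
    from (inj₂ (a , pq)) = a , ∧-fst pq

    from-to : ∀ a p b e → from (by a p b e) ≡ (a , p)
    from-to a p true  e = Sat-≡ refl
    from-to a p false e = Sat-≡ refl

    to-from : ∀ x → to (from x) ≡ x
    to-from (inj₁ (a , pq)) = go (Q a) refl
      where
      go : ∀ b e → by a (∧-fst pq) b e ≡ inj₁ (a , pq)
      go true  e = cong inj₁ (Sat-≡ refl)
      go false e = ⊥-elim (subst T e (∧-snd {P a} pq))
    to-from (inj₂ (a , pq)) = go (Q a) refl
      where
      go : ∀ b e → by a (∧-fst pq) b e ≡ inj₂ (a , pq)
      go false e = cong inj₂ (Sat-≡ refl)
      go true  e = ⊥-elim (subst (λ b → T (not b)) e (∧-snd {P a} pq))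

  Sat-empty : {A : Set} {P : A → Bool} → (∀ a → T (P a) → ⊥) → Sat P ↔ Fin 0
  Sat-empty h = mk↔ₛ′ (λ (a , p) → ⊥-elim (h a p)) (λ ()) (λ ()) (λ (a , p) → ⊥-elim (h a p))

  Sat-unique : {A : Set} {P : A → Bool} (a₀ : A) → T (P a₀) → (∀ a → T (P a) → a ≡ a₀) →
    Sat P ↔ Fin 1
  Sat-unique a₀ p₀ h =
    mk↔ₛ′ (λ _ → zero) (λ _ → a₀ , p₀) (λ { zero → refl }) (λ (a , p) → Sat-≡ (sym (h a p)))

  Fin-cast : {a b : ℕ} → a ≡ b → Fin a ↔ Fin b
  Fin-cast refl = ↔-refl

  ⊎-Fin : {X Y : Set} {a b : ℕ} → X ↔ Fin a → Y ↔ Fin b → (X ⊎ Y) ↔ Fin (a + b)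
  ⊎-Fin φ ψ = ↔-trans (φ ⊎-↔ ψ) (↔-sym +↔⊎)

  module _ {X : Set} {n : ℕ} (φ : (X ⊎ ⊤) ↔ Fin (suc n)) where
    open Inverse φ

    private
      hole : Fin (suc n)
      hole = to (inj₂ tt)

      to-injective : ∀ {a b} → to a ≡ to b → a ≡ b
      to-injective {a} {b} e = trans (sym (strictlyInverseʳ a)) (trans (cong from e) (strictlyInverseʳ b))

      hole≢ : ∀ x → hole ≢ to (inj₁ x)
      hole≢ x e with to-injective e
      ... | ()

      lower : X → Fin n
      lower x = punchOut (hole≢ x)

      preimage : ∀ j → Σ X λ x → to (inj₁ x) ≡ punchIn hole j
      preimage j with from (punchIn hole j) in e
      ... | inj₁ x = x , trans (cong to (sym e)) (strictlyInverseˡ (punchIn hole j))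
      ... | inj₂ tt = ⊥-elim (punchInᵢ≢i hole j (trans (sym (strictlyInverseˡ _)) (cong to e)))

    ⊎⊤-cancel : X ↔ Fin n
    ⊎⊤-cancel = mk↔ₛ′ lower (λ j → proj₁ (preimage j)) lower-raise raise-lower
      where
      lower-raise : ∀ j → lower (proj₁ (preimage j)) ≡ j
      lower-raise j = trans (punchOut-cong hole (proj₂ (preimage j))) (punchOut-punchIn hole)

      raise-lower : ∀ x → proj₁ (preimage (lower x)) ≡ x
      raise-lower x =
        inj₁-injective (to-injective (trans (proj₂ (preimage (lower x))) (punchIn-punchOut (hole≢ x))))

  ⊎-Fin-cancel : {X : Set} (b a : ℕ) → (X ⊎ Fin b) ↔ Fin a → (b ≤ a) × (X ↔ Fin (a ∸ b))
  ⊎-Fin-cancel zero a φ = z≤n , ↔-trans (↔-sym ⊎-Fin0) φ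
    where
    ⊎-Fin0 : {X : Set} → (X ⊎ Fin 0) ↔ X
    ⊎-Fin0 = mk↔ₛ′ (λ { (inj₁ x) → x ; (inj₂ ()) }) inj₁
                   (λ _ → refl) (λ { (inj₁ x) → refl ; (inj₂ ()) })
  ⊎-Fin-cancel (suc b) zero φ with Inverse.to φ (inj₂ zero)
  ... | ()
  ⊎-Fin-cancel {X} (suc b) (suc a) φ
    with ⊎-Fin-cancel b a
           (⊎⊤-cancel (↔-trans (⊎-assoc _ X (Fin b) ⊤) (↔-trans (↔-refl ⊎-↔ split-last) φ)))
    where
    split-last : (Fin b ⊎ ⊤) ↔ Fin (suc b)
    split-last = ↔-trans (⊎-comm _ _) (⊎-Fin (↔-sym 1↔⊤) ↔-refl)
  ... | b≤a , ψ = s≤s b≤a , ψ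

  ∧-assoc₅ : ∀ a b c d e → (a ∧ b ∧ c ∧ d) ∧ e ≡ a ∧ b ∧ c ∧ d ∧ e
  ∧-assoc₅ false _     _     _ _ = refl
  ∧-assoc₅ true  false _     _ _ = refl
  ∧-assoc₅ true  true  false _ _ = refl
  ∧-assoc₅ true  true  true  _ _ = refl

  all-true : ∀ {A : Set} {p : A → Bool} → (∀ x → T (p x)) → ∀ xs → T (all p xs)
  all-true h []       = tt
  all-true h (x ∷ xs) = ∧-intro (h x) (all-true h xs)

  all-++ : ∀ {A : Set} (p : A → Bool) xs ys → all p (xs ++ ys) ≡ all p xs ∧ all p ys
  all-++ p []       ys = refl
  all-++ p (x ∷ xs) ys = trans (cong (p x ∧_) (all-++ p xs ys)) (sym (∧-assoc (p x) _ _))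

  take-++ : ∀ {A : Set} (ys zs : List A) → take (length ys) (ys ++ zs) ≡ ys
  take-++ []       zs = refl
  take-++ (y ∷ ys) zs = cong (y ∷_) (take-++ ys zs)

  drop-++ : ∀ {A : Set} (ys zs : List A) → drop (length ys) (ys ++ zs) ≡ zs
  drop-++ []       zs = refl
  drop-++ (y ∷ ys) zs = drop-++ ys zs


module AlternatingSums where

  open Subtypes
  open import Defs using (sumTo; sign)
  open import Data.Bool using (Bool; _∧_; not; T)
  open import Data.Nat as ℕ using (ℕ; zero; suc; _∸_; _≤_; _<_; s≤s; _≡ᵇ_)
  open import Data.Nat.Properties as ℕ using (≡ᵇ⇒≡)
  open import Data.Nat.Combinatorics using (_C_; nCk+nC[k+1]≡[n+1]C[k+1]; k>n⇒nCk≡0)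
  open import Data.Integer as ℤ using (ℤ; +_; -_; 0ℤ; 1ℤ; _+_; _*_; _-_)
  open import Data.Integer.Properties as ℤ using (pos-+)
  open import Data.Integer.Tactic.RingSolver using (solve-∀)
  open import Data.List using (_∷_; foldr; map; applyUpTo)
  open import Data.Product using (Σ; _×_; _,_)
  open import Data.Sum using (_⊎_)
  open import Data.Fin using (Fin)
  open import Function.Bundles using (_↔_)
  open import Function.Properties.Inverse using (↔-refl; ↔-sym; ↔-trans)
  open import Data.Sum.Function.Propositional using (_⊎-↔_)
  open import Relation.Binary.PropositionalEquality
  open ≡-Reasoning

  HasCard : Set → ℤ → Set
  HasCard X z = Σ ℕ λ N → (X ↔ Fin N) × (+ N ≡ z)

  HasCard-↔ : {X Y : Set} {z : ℤ} → X ↔ Y → HasCard Y z → HasCard X z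
  HasCard-↔ φ (N , ψ , e) = N , ↔-trans φ ψ , e

  HasCard-≡ : {X : Set} {z w : ℤ} → z ≡ w → HasCard X z → HasCard X w
  HasCard-≡ refl c = c

  sumBelow : ℕ → (ℕ → ℤ) → ℤ
  sumBelow K f = foldr _+_ 0ℤ (applyUpTo f K)

  sumTo≡sumBelow : ∀ n f → sumTo n f ≡ sumBelow (suc n) f
  sumTo≡sumBelow n f = cong (foldr _+_ 0ℤ) (map-applyUpTo (λ i → i) (suc n))
    where
    map-applyUpTo : ∀ g K → map f (applyUpTo g K) ≡ applyUpTo (λ i → f (g i)) K
    map-applyUpTo g zero = refl
    map-applyUpTo g (suc K) = cong (f (g 0) ∷_) (map-applyUpTo (λ i → g (suc i)) K)

  sumBelow-suc : ∀ K f → sumBelow (suc K) f ≡ sumBelow K f + f K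
  sumBelow-suc zero f = trans (ℤ.+-identityʳ (f 0)) (sym (ℤ.+-identityˡ (f 0)))
  sumBelow-suc (suc K) f =
    trans (cong (_+_ (f 0)) (sumBelow-suc K (λ i → f (suc i)))) (sym (ℤ.+-assoc (f 0) _ _))

  sumBelow-cong : ∀ K {f g} → (∀ i → f i ≡ g i) → sumBelow K f ≡ sumBelow K g
  sumBelow-cong zero e = refl
  sumBelow-cong (suc K) e = cong₂ _+_ (e 0) (sumBelow-cong K (λ i → e (suc i)))

  sumBelow-+ : ∀ K f g → sumBelow K (λ i → f i + g i) ≡ sumBelow K f + sumBelow K g
  sumBelow-+ zero f g = refl
  sumBelow-+ (suc K) f g =
    trans (cong (_+_ (f 0 + g 0)) (sumBelow-+ K (λ i → f (suc i)) (λ i → g (suc i))))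
          (interchange (f 0) (g 0) _ _)
    where
    interchange : ∀ a b c d → (a + b) + (c + d) ≡ (a + c) + (b + d)
    interchange = solve-∀

  sumBelow-neg : ∀ K f → sumBelow K (λ i → - f i) ≡ - sumBelow K f
  sumBelow-neg zero f = refl
  sumBelow-neg (suc K) f =
    trans (cong (_+_ (- f 0)) (sumBelow-neg K (λ i → f (suc i)))) (sym (ℤ.neg-distrib-+ (f 0) _))

  alternatingSum : (ℕ → ℕ) → ℕ → ℕ → ℤ
  alternatingSum F t k = sumBelow (suc t) (λ i → sign i * + (t C i) * + F (k ∸ i))

  alternatingSum-pascal : ∀ F t k →
    alternatingSum F (suc t) (suc k) ≡ alternatingSum F t (suc k) - alternatingSum F t k
  alternatingSum-pascal F t k = begin
    alternatingSum F (suc t) (suc k)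
      ≡⟨ cong (_+_ a₀) (trans (sumBelow-cong (suc t) pascal) (sumBelow-+ (suc t) A B)) ⟩
    a₀ + (sumBelow (suc t) A + sumBelow (suc t) B)
      ≡⟨ sym (ℤ.+-assoc a₀ _ _) ⟩
    (a₀ + sumBelow (suc t) A) + sumBelow (suc t) B
      ≡⟨ cong₂ _+_ shifted negated ⟩
    alternatingSum F t (suc k) - alternatingSum F t k ∎
    where
    a₀ = sign 0 * + (t C 0) * + F (suc k)
    A B : ℕ → ℤ
    A i = sign (suc i) * + (t C suc i) * + F (k ∸ i)
    B i = sign (suc i) * + (t C i) * + F (k ∸ i)

    distrib : ∀ s a b f → s * (a + b) * f ≡ s * b * f + s * a * f
    distrib = solve-∀

    pascal : ∀ i → sign (suc i) * + (suc t C suc i) * + F (k ∸ i) ≡ A i + B i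
    pascal i = begin
      sign (suc i) * + (suc t C suc i) * + F (k ∸ i)
        ≡⟨ cong (λ x → sign (suc i) * + x * + F (k ∸ i)) (sym (nCk+nC[k+1]≡[n+1]C[k+1] t i)) ⟩
      sign (suc i) * + (t C i ℕ.+ t C suc i) * + F (k ∸ i)
        ≡⟨ cong (λ x → sign (suc i) * x * + F (k ∸ i)) (pos-+ (t C i) (t C suc i)) ⟩
      sign (suc i) * (+ (t C i) + + (t C suc i)) * + F (k ∸ i)
        ≡⟨ distrib (sign (suc i)) (+ (t C i)) (+ (t C suc i)) (+ F (k ∸ i)) ⟩
      A i + B i ∎

    vanishing : ∀ a s f → a + s * + 0 * f ≡ a
    vanishing = solve-∀

    last-vanishes : ∀ a s f → a + s * + (t C suc t) * f ≡ a
    last-vanishes a s f rewrite k>n⇒nCk≡0 (ℕ.n<1+n t) = vanishing a s f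

    shifted : a₀ + sumBelow (suc t) A ≡ alternatingSum F t (suc k)
    shifted = trans (sumBelow-suc (suc t) (λ i → sign i * + (t C i) * + F (suc k ∸ i)))
                    (last-vanishes (alternatingSum F t (suc k)) (sign (suc t)) (+ F (k ∸ t)))

    negate : ∀ s a f → (- 1ℤ * s) * a * f ≡ - (s * a * f)
    negate = solve-∀

    negated : sumBelow (suc t) B ≡ - alternatingSum F t k
    negated = trans (sumBelow-cong (suc t) (λ i → negate (sign i) (+ (t C i)) (+ F (k ∸ i))))
                    (sumBelow-neg (suc t) (λ i → sign i * + (t C i) * + F (k ∸ i)))

  inclusionExclusion : (ℕ → ℕ) → ℕ → ℤ
  inclusionExclusion F k = sumTo k (λ i → sign i * + (k C i) * + F (k ∸ i))

  module InclusionExclusion (W : ℕ → ℕ → Set) (F : ℕ → ℕ)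
    (W-base : ∀ k → W k 0 ↔ Fin (F k))
    (W-split : ∀ k t → t ≤ k → W (suc k) t ↔ (W (suc k) (suc t) ⊎ W k t)) where

    W-card : ∀ t k → t ≤ k → HasCard (W k t) (alternatingSum F t k)
    W-card zero k _ = F k , W-base k , sym (unit (+ F k))
      where
      unit : ∀ f → 1ℤ * 1ℤ * f + 0ℤ ≡ f
      unit = solve-∀
    -- W (k+1) (t+1) is the complement of a copy of W k t in W (k+1) t, so its size is a difference.
    W-card (suc t) (suc k) (s≤s t≤k)
      with W-card t (suc k) (ℕ.m≤n⇒m≤1+n t≤k) | W-card t k t≤k
    ... | N₁ , φ₁ , e₁ | N₂ , φ₂ , e₂
      with ⊎-Fin-cancel N₂ N₁
             (↔-trans (↔-refl ⊎-↔ ↔-sym φ₂) (↔-trans (↔-sym (W-split k t t≤k)) φ₁))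
    ... | N₂≤N₁ , ψ = N₁ ∸ N₂ , ψ , (begin
      + (N₁ ∸ N₂)                                         ≡⟨ sym (ℤ.⊖-≥ N₂≤N₁) ⟩
      N₁ ℤ.⊖ N₂                                           ≡⟨ sym (ℤ.m-n≡m⊖n N₁ N₂) ⟩
      + N₁ - + N₂                                         ≡⟨ cong₂ _-_ e₁ e₂ ⟩
      alternatingSum F t (suc k) - alternatingSum F t k   ≡⟨ sym (alternatingSum-pascal F t k) ⟩
      alternatingSum F (suc t) (suc k)                    ∎)

    W-card-diagonal : ∀ k → HasCard (W k k) (inclusionExclusion F k)
    W-card-diagonal k =
      HasCard-≡ (sym (sumTo≡sumBelow k (λ i → sign i * + (k C i) * + F (k ∸ i)))) (W-card k k ℕ.≤-refl)

  HasCard-fibres : {A : Set} (P : A → Bool) (φ : A → ℕ) (K : ℕ) (v : ℕ → ℤ)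
    → (∀ a → T (P a) → φ a < K)
    → (∀ k → k < K → HasCard (Sat (λ a → P a ∧ (φ a ≡ᵇ k))) (v k))
    → HasCard (Sat P) (sumBelow K v)
  HasCard-fibres P φ zero v bound fibre = 0 , Sat-empty (λ a p → ℕ.n≮0 (bound a p)) , refl
  HasCard-fibres P φ (suc K) v bound fibre
    with fibre K ℕ.≤-refl | HasCard-fibres (λ a → P a ∧ not (φ a ≡ᵇ K)) φ K v bound′ fibre′
    where
    bound′ : ∀ a → T (P a ∧ not (φ a ≡ᵇ K)) → φ a < K
    bound′ a p = ℕ.≤∧≢⇒< (ℕ.≤-pred (bound a (∧-fst p))) (≢ᵇ⇒≢ (φ a) K (∧-snd {P a} p))
    fibre′ : ∀ k → k < K → HasCard (Sat (λ a → (P a ∧ not (φ a ≡ᵇ K)) ∧ (φ a ≡ᵇ k))) (v k)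
    fibre′ k k<K = HasCard-↔ (Sat-⇔ forget remember) (fibre k (ℕ.m≤n⇒m≤1+n k<K))
      where
      forget : ∀ a → T ((P a ∧ not (φ a ≡ᵇ K)) ∧ (φ a ≡ᵇ k)) → T (P a ∧ (φ a ≡ᵇ k))
      forget a p = ∧-intro (∧-fst (∧-fst p)) (∧-snd {P a ∧ not (φ a ≡ᵇ K)} p)
      remember : ∀ a → T (P a ∧ (φ a ≡ᵇ k)) → T ((P a ∧ not (φ a ≡ᵇ K)) ∧ (φ a ≡ᵇ k))
      remember a p = ∧-intro (∧-intro (∧-fst p) (≢⇒≢ᵇ (φ a) K φa≢K)) (∧-snd {P a} p)
        where
        φa≢K : φ a ≢ K
        φa≢K e = ℕ.<-irrefl (trans (sym (≡ᵇ⇒≡ _ _ (∧-snd {P a} p))) e) k<K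
  ... | N₁ , ψ₁ , e₁ | N₂ , ψ₂ , e₂ =
    N₁ ℕ.+ N₂ , ↔-trans (Sat-split P (λ a → φ a ≡ᵇ K)) (⊎-Fin ψ₁ ψ₂) ,
    trans (pos-+ N₁ N₂) (trans (cong₂ _+_ e₁ e₂) (trans (ℤ.+-comm (v K) _) (sym (sumBelow-suc K v))))


module Compositions where

  open Subtypes
  open import Defs using (multichoose)
  open import Data.Bool using (Bool; true; false; _∧_; not; T)
  open import Data.Bool.ListAction using (all)
  open import Data.Nat as ℕ using (ℕ; zero; suc; _+_; _≡ᵇ_; _≤ᵇ_)
  open import Data.Nat.Properties as ℕ using (≡ᵇ⇒≡; ≡⇒≡ᵇ)
  open import Data.Nat.ListAction using (sum)
  open import Data.Nat.Combinatorics using (_C_; nCk+nC[k+1]≡[n+1]C[k+1]; nCn≡1)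
  open import Data.List using (List; []; _∷_; length; replicate)
  open import Data.List.Properties using (length-replicate)
  open import Data.Fin using (Fin)
  open import Data.Empty using (⊥; ⊥-elim)
  open import Data.Unit using (tt)
  open import Function.Bundles using (_↔_)
  open import Function.Properties.Inverse using (↔-trans)
  open import Relation.Binary.PropositionalEquality

  IsComposition : (ℕ → Bool) → ℕ → ℕ → List ℕ → Bool
  IsComposition allowed L n xs = all allowed xs ∧ (sum xs ≡ᵇ n) ∧ (length xs ≡ᵇ L)

  headIsZero : List ℕ → Bool
  headIsZero []      = false
  headIsZero (x ∷ _) = x ≡ᵇ 0

  tail : List ℕ → List ℕ
  tail []       = []
  tail (_ ∷ xs) = xs

  multichoose-pascal : ∀ a b → multichoose a (suc b) + multichoose (suc a) b ≡ multichoose (suc a) (suc b)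
  multichoose-pascal zero    b = trans (nCn≡1 b) (sym (nCn≡1 (suc b)))
  multichoose-pascal (suc a) b = begin
    (a + suc b) C suc b + (suc a + b) C b  ≡⟨ cong (λ x → (a + suc b) C suc b + x C b) (sym (ℕ.+-suc a b)) ⟩
    (a + suc b) C suc b + (a + suc b) C b  ≡⟨ ℕ.+-comm ((a + suc b) C suc b) _ ⟩
    (a + suc b) C b + (a + suc b) C suc b  ≡⟨ nCk+nC[k+1]≡[n+1]C[k+1] (a + suc b) b ⟩
    suc (a + suc b) C suc b                ∎
    where open ≡-Reasoning

  module WithParts (allowed : ℕ → Bool) (allowed-0 : T (allowed 0)) where

    Comp : ℕ → ℕ → List ℕ → Bool
    Comp = IsComposition allowed

    Comp-0-suc : ∀ n → Sat (Comp 0 (suc n)) ↔ Fin 0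
    Comp-0-suc n = Sat-empty no-parts
      where
      no-parts : ∀ xs → T (Comp 0 (suc n) xs) → ⊥
      no-parts (x ∷ xs) p = ∧-snd {sum (x ∷ xs) ≡ᵇ suc n} (∧-snd {all allowed (x ∷ xs)} p)

    Comp-L-0 : ∀ L → Sat (Comp L 0) ↔ Fin 1
    Comp-L-0 L = Sat-unique (replicate L 0) zeros-comp only-zeros
      where
      all-zeros : ∀ L → T (all allowed (replicate L 0))
      all-zeros zero    = tt
      all-zeros (suc L) = ∧-intro allowed-0 (all-zeros L)

      sum-zeros : ∀ L → sum (replicate L 0) ≡ 0
      sum-zeros zero    = refl
      sum-zeros (suc L) = sum-zeros L

      zeros-comp : T (Comp L 0 (replicate L 0))
      zeros-comp = ∧-intro (all-zeros L)
        (∧-intro (≡⇒≡ᵇ _ _ (sum-zeros L)) (≡⇒≡ᵇ _ _ (length-replicate L)))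

      sum≡0 : ∀ xs → sum xs ≡ 0 → xs ≡ replicate (length xs) 0
      sum≡0 []         _ = refl
      sum≡0 (zero ∷ xs) e = cong (0 ∷_) (sum≡0 xs e)

      only-zeros : ∀ xs → T (Comp L 0 xs) → xs ≡ replicate L 0
      only-zeros xs p = trans (sum≡0 xs (≡ᵇ⇒≡ _ _ (∧-fst rest)))
                              (cong (λ l → replicate l 0) (≡ᵇ⇒≡ _ _ (∧-snd {sum xs ≡ᵇ 0} rest)))
        where rest = ∧-snd {all allowed xs} p

    head-zero : ∀ L n → Sat (λ xs → Comp (suc L) n xs ∧ headIsZero xs) ↔ Sat (Comp L n)
    head-zero L n = Sat-↔ tail (0 ∷_) drop-0 cons-0 (λ xs p → cons-tail xs (∧-snd p)) (λ _ _ → refl)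
      where
      drop-0 : ∀ xs → T (Comp (suc L) n xs ∧ headIsZero xs) → T (Comp L n (tail xs))
      drop-0 []           p = ⊥-elim (∧-snd {Comp (suc L) n []} p)
      drop-0 (zero ∷ xs)  p = let q = ∧-fst p in
        ∧-intro (∧-snd {allowed 0} (∧-fst q)) (∧-snd {allowed 0 ∧ all allowed xs} q)
      drop-0 (suc x ∷ xs) p = ⊥-elim (∧-snd {Comp (suc L) n (suc x ∷ xs)} p)
      cons-0 : ∀ xs → T (Comp L n xs) → T (Comp (suc L) n (0 ∷ xs) ∧ headIsZero (0 ∷ xs))
      cons-0 xs p = ∧-intro (∧-intro (∧-intro allowed-0 (∧-fst p)) (∧-snd {all allowed xs} p)) tt
      cons-tail : ∀ xs → T (headIsZero xs) → 0 ∷ tail xs ≡ xs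
      cons-tail (zero ∷ xs) _ = refl

    count-by-head : ∀ L n {c₀ c₁} →
      Sat (Comp L (suc n)) ↔ Fin c₀ →
      Sat (λ xs → Comp (suc L) (suc n) xs ∧ not (headIsZero xs)) ↔ Fin c₁ →
      Sat (Comp (suc L) (suc n)) ↔ Fin (c₀ + c₁)
    count-by-head L n zero-head nonzero-head =
      ↔-trans (Sat-split (Comp (suc L) (suc n)) headIsZero)
              (⊎-Fin (↔-trans (head-zero L (suc n)) zero-head) nonzero-head)

  open WithParts using (Comp-0-suc; Comp-L-0; count-by-head)

  WeakComp : ℕ → ℕ → List ℕ → Bool
  WeakComp = IsComposition (λ _ → true)

  BinaryComp : ℕ → ℕ → List ℕ → Bool
  BinaryComp = IsComposition (_≤ᵇ 1)

  head-pred : ∀ L n → Sat (λ xs → WeakComp (suc L) (suc n) xs ∧ not (headIsZero xs)) ↔ Sat (WeakComp (suc L) n)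
  head-pred L n = Sat-↔ decHead incHead dec-comp inc-comp inc-dec dec-inc
    where
    decHead incHead : List ℕ → List ℕ
    decHead []       = []
    decHead (x ∷ xs) = ℕ.pred x ∷ xs
    incHead []       = []
    incHead (x ∷ xs) = suc x ∷ xs

    NonzeroHead : List ℕ → Bool
    NonzeroHead xs = WeakComp (suc L) (suc n) xs ∧ not (headIsZero xs)

    dec-comp : ∀ xs → T (NonzeroHead xs) → T (WeakComp (suc L) n (decHead xs))
    dec-comp (zero ∷ xs)  p = ⊥-elim (∧-false p)
    dec-comp (suc x ∷ xs) p = ∧-fst p
    inc-comp : ∀ xs → T (WeakComp (suc L) n xs) → T (NonzeroHead (incHead xs))
    inc-comp []       p = ⊥-elim (∧-false p)
    inc-comp (x ∷ xs) p = ∧-intro p tt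
    dec-inc : ∀ xs → T (WeakComp (suc L) n xs) → decHead (incHead xs) ≡ xs
    dec-inc []       _ = refl
    dec-inc (x ∷ xs) _ = refl
    inc-dec : ∀ xs → T (NonzeroHead xs) → incHead (decHead xs) ≡ xs
    inc-dec (zero ∷ xs)  p = ⊥-elim (∧-false p)
    inc-dec (suc x ∷ xs) _ = refl

  weak-compositions-card : ∀ L n → Sat (WeakComp L n) ↔ Fin (multichoose L n)
  weak-compositions-card zero    zero    = Comp-L-0 _ tt 0
  weak-compositions-card zero    (suc n) = Comp-0-suc _ tt n
  weak-compositions-card (suc L) zero    = Comp-L-0 _ tt (suc L)
  weak-compositions-card (suc L) (suc n) =
    ↔-trans (count-by-head _ tt L n (weak-compositions-card L (suc n))
                                    (↔-trans (head-pred L n) (weak-compositions-card (suc L) n)))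
            (Fin-cast (multichoose-pascal L n))

  head-one : ∀ L n → Sat (λ xs → BinaryComp (suc L) (suc n) xs ∧ not (headIsZero xs)) ↔ Sat (BinaryComp L n)
  head-one L n = Sat-↔ tail (1 ∷_) drop-1 (λ _ p → ∧-intro p tt) cons-tail (λ _ _ → refl)
    where
    NonzeroHead : List ℕ → Bool
    NonzeroHead xs = BinaryComp (suc L) (suc n) xs ∧ not (headIsZero xs)

    drop-1 : ∀ xs → T (NonzeroHead xs) → T (BinaryComp L n (tail xs))
    drop-1 (0 ∷ xs)           p = ⊥-elim (∧-false p)
    drop-1 (1 ∷ xs)           p = ∧-fst p
    drop-1 (suc (suc x) ∷ xs) ()
    cons-tail : ∀ xs → T (NonzeroHead xs) → 1 ∷ tail xs ≡ xs
    cons-tail (0 ∷ xs)           p = ⊥-elim (∧-false p)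
    cons-tail (1 ∷ xs)           _ = refl
    cons-tail (suc (suc x) ∷ xs) ()

  binary-compositions-card : ∀ L n → Sat (BinaryComp L n) ↔ Fin (L C n)
  binary-compositions-card zero    zero    = Comp-L-0 _ tt 0
  binary-compositions-card zero    (suc n) = Comp-0-suc _ tt n
  binary-compositions-card (suc L) zero    = Comp-L-0 _ tt (suc L)
  binary-compositions-card (suc L) (suc n) =
    ↔-trans (count-by-head _ tt L n (binary-compositions-card L (suc n))
                                    (↔-trans (head-one L n) (binary-compositions-card L n)))
            (Fin-cast (trans (ℕ.+-comm (L C suc n) (L C n)) (nCk+nC[k+1]≡[n+1]C[k+1] L n)))


module MatrixCounting where

  open Subtypes
  open AlternatingSums
  open Compositions using (IsComposition; weak-compositions-card; binary-compositions-card)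
  open import Defs using (colSum; nonzeroColᵇ; sumTo; multichoose; G; G01)
  open import Data.Nat.Combinatorics using (_C_)
  open import Data.Bool using (Bool; true; _∧_; not; T)
  open import Data.Bool.Properties using (∧-assoc; ∧-identityʳ)
  open import Data.Bool.ListAction using (all)
  open import Data.Nat as ℕ using (ℕ; zero; suc; _+_; _*_; _∸_; _≤_; _<_; z≤n; s≤s; _≡ᵇ_; _≤ᵇ_)
  open import Data.Nat.Properties as ℕ using (≡ᵇ⇒≡; ≡⇒≡ᵇ)
  open import Data.Nat.ListAction using (sum)
  open import Data.Nat.ListAction.Properties using (sum-++)
  open import Data.List using (List; []; _∷_; length; _++_; drop; map)
  open import Data.List.Properties using (length-++; length-drop)
  open import Data.Vec as Vec using (Vec; toList)
  open import Data.Vec.Properties using (length-toList)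
  open import Data.Sum using (_⊎_)
  open import Data.Fin using (Fin)
  open import Data.Empty using (⊥-elim)
  open import Data.Unit using (tt)
  open import Function.Bundles using (_↔_)
  open import Function.Properties.Inverse using (↔-trans)
  open import Data.Sum.Function.Propositional using (_⊎-↔_)
  open import Relation.Binary.PropositionalEquality

  removeAt : {A : Set} → ℕ → List A → List A
  removeAt _       []       = []
  removeAt zero    (c ∷ cs) = cs
  removeAt (suc t) (c ∷ cs) = c ∷ removeAt t cs

  insertAt : {A : Set} → ℕ → A → List A → List A
  insertAt zero    z cs       = z ∷ cs
  insertAt (suc t) z []       = z ∷ []
  insertAt (suc t) z (c ∷ cs) = c ∷ insertAt t z cs

  removeAt-insertAt : {A : Set} → ∀ t (z : A) cs → t ≤ length cs → removeAt t (insertAt t z cs) ≡ cs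
  removeAt-insertAt zero    z cs       _         = refl
  removeAt-insertAt (suc t) z (c ∷ cs) (s≤s t≤) = cong (c ∷_) (removeAt-insertAt t z cs t≤)

  length-insertAt : {A : Set} → ∀ t (z : A) cs → length (insertAt t z cs) ≡ suc (length cs)
  length-insertAt zero    z cs       = refl
  length-insertAt (suc t) z []       = refl
  length-insertAt (suc t) z (c ∷ cs) = cong suc (length-insertAt t z cs)

  all-insertAt : {A : Set} (p : A → Bool) → ∀ t z cs → T (p z) → T (all p cs) →
    T (all p (insertAt t z cs))
  all-insertAt p zero    z cs       pz pcs = ∧-intro pz pcs
  all-insertAt p (suc t) z []       pz _   = ∧-intro pz tt
  all-insertAt p (suc t) z (c ∷ cs) pz pcs = ∧-intro (∧-fst pcs) (all-insertAt p t z cs pz (∧-snd {p c} pcs))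

  all-removeAt : {A : Set} (p : A → Bool) → ∀ t cs → T (all p cs) → T (all p (removeAt t cs))
  all-removeAt p _       []       _   = tt
  all-removeAt p zero    (c ∷ cs) pcs = ∧-snd {p c} pcs
  all-removeAt p (suc t) (c ∷ cs) pcs = ∧-intro (∧-fst pcs) (all-removeAt p t cs (∧-snd {p c} pcs))

  zeroCol : (m : ℕ) → Vec ℕ m
  zeroCol m = Vec.replicate m 0

  zero-column : ∀ {m} (c : Vec ℕ m) → T (not (nonzeroColᵇ c)) → c ≡ zeroCol m
  zero-column Vec.[]           _ = refl
  zero-column (zero Vec.∷ c) z = cong (0 Vec.∷_) (zero-column c z)

  zeroCol-zero : ∀ m → T (not (nonzeroColᵇ (zeroCol m)))
  zeroCol-zero zero    = tt
  zeroCol-zero (suc m) = zeroCol-zero m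

  colSum-zeroCol : ∀ m → colSum (zeroCol m) ≡ 0
  colSum-zeroCol zero    = refl
  colSum-zeroCol (suc m) = colSum-zeroCol m

  module MatrixFamily (m n : ℕ) (allowed : ℕ → Bool) (allowed-0 : T (allowed 0)) where

    Col : Set
    Col = Vec ℕ m

    colAllowed : Col → Bool
    colAllowed c = all allowed (toList c)

    total : List Col → ℕ
    total cs = sum (map colSum cs)

    nonzeroPrefix : ℕ → List Col → Bool
    nonzeroPrefix zero    _        = true
    nonzeroPrefix (suc t) []       = true
    nonzeroPrefix (suc t) (c ∷ cs) = nonzeroColᵇ c ∧ nonzeroPrefix t cs

    nonzeroAt : ℕ → List Col → Bool
    nonzeroAt _       []       = true
    nonzeroAt zero    (c ∷ cs) = nonzeroColᵇ c
    nonzeroAt (suc t) (c ∷ cs) = nonzeroAt t cs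

    Matrix : ℕ → ℕ → List Col → Bool
    Matrix k t cs = all colAllowed cs ∧ (total cs ≡ᵇ n) ∧ (length cs ≡ᵇ k) ∧ nonzeroPrefix t cs

    record IsMatrix (k t : ℕ) (cs : List Col) : Set where
      constructor matrix
      field
        entries : T (all colAllowed cs)
        total≡  : total cs ≡ n
        length≡ : length cs ≡ k
        prefix  : T (nonzeroPrefix t cs)

    isMatrix : ∀ {k t} cs → T (Matrix k t cs) → IsMatrix k t cs
    isMatrix {k} cs p =
      matrix (∧-fst p) (≡ᵇ⇒≡ _ _ (∧-fst q)) (≡ᵇ⇒≡ _ _ (∧-fst r)) (∧-snd {length cs ≡ᵇ k} r)
      where
      q = ∧-snd {all colAllowed cs} p
      r = ∧-snd {total cs ≡ᵇ n} q

    Matrix-intro : ∀ {k t} cs → IsMatrix k t cs → T (Matrix k t cs)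
    Matrix-intro _ (matrix e s l p) = ∧-intro e (∧-intro (≡⇒≡ᵇ _ _ s) (∧-intro (≡⇒≡ᵇ _ _ l) p))

    colAllowed-zeroCol : ∀ {l} → T (all allowed (toList (zeroCol l)))
    colAllowed-zeroCol {zero}  = tt
    colAllowed-zeroCol {suc l} = ∧-intro allowed-0 (colAllowed-zeroCol {l})

    nonzeroPrefix-suc : ∀ t cs → nonzeroPrefix (suc t) cs ≡ nonzeroPrefix t cs ∧ nonzeroAt t cs
    nonzeroPrefix-suc zero    []       = refl
    nonzeroPrefix-suc zero    (c ∷ cs) = ∧-identityʳ (nonzeroColᵇ c)
    nonzeroPrefix-suc (suc t) []       = refl
    nonzeroPrefix-suc (suc t) (c ∷ cs) =
      trans (cong (nonzeroColᵇ c ∧_) (nonzeroPrefix-suc t cs)) (sym (∧-assoc (nonzeroColᵇ c) _ _))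

    nonzeroPrefix-removeAt : ∀ t cs → nonzeroPrefix t (removeAt t cs) ≡ nonzeroPrefix t cs
    nonzeroPrefix-removeAt zero    []       = refl
    nonzeroPrefix-removeAt zero    (c ∷ cs) = refl
    nonzeroPrefix-removeAt (suc t) []       = refl
    nonzeroPrefix-removeAt (suc t) (c ∷ cs) = cong (nonzeroColᵇ c ∧_) (nonzeroPrefix-removeAt t cs)

    nonzeroPrefix-insertAt : ∀ t z cs → t ≤ length cs →
      nonzeroPrefix t (insertAt t z cs) ≡ nonzeroPrefix t cs
    nonzeroPrefix-insertAt zero    z cs       _         = refl
    nonzeroPrefix-insertAt (suc t) z (c ∷ cs) (s≤s t≤) =
      cong (nonzeroColᵇ c ∧_) (nonzeroPrefix-insertAt t z cs t≤)

    zero-at-insertAt : ∀ t cs → t ≤ length cs → T (not (nonzeroAt t (insertAt t (zeroCol m) cs)))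
    zero-at-insertAt zero    cs       _         = zeroCol-zero m
    zero-at-insertAt (suc t) (c ∷ cs) (s≤s t≤) = zero-at-insertAt t cs t≤

    total-insertAt-zeroCol : ∀ t cs → total (insertAt t (zeroCol m) cs) ≡ total cs
    total-insertAt-zeroCol zero    cs       = cong (_+ total cs) (colSum-zeroCol m)
    total-insertAt-zeroCol (suc t) []       = trans (ℕ.+-identityʳ _) (colSum-zeroCol m)
    total-insertAt-zeroCol (suc t) (c ∷ cs) = cong (colSum c +_) (total-insertAt-zeroCol t cs)

    insertAt-removeAt-zero : ∀ t cs → T (not (nonzeroAt t cs)) → insertAt t (zeroCol m) (removeAt t cs) ≡ cs
    insertAt-removeAt-zero zero    (c ∷ cs) z = cong (_∷ cs) (sym (zero-column c z))
    insertAt-removeAt-zero (suc t) (c ∷ cs) z = cong (c ∷_) (insertAt-removeAt-zero t cs z)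

    remove-zero-column : ∀ k t → t ≤ k →
      Sat (λ cs → Matrix (suc k) t cs ∧ not (nonzeroAt t cs)) ↔ Sat (Matrix k t)
    remove-zero-column k t t≤k = Sat-↔ (removeAt t) (insertAt t (zeroCol m)) remove insert
      (λ cs p → insertAt-removeAt-zero t cs (∧-snd {Matrix (suc k) t cs} p))
      (λ cs p → removeAt-insertAt t (zeroCol m) cs (t≤length (isMatrix {k} {t} cs p)))
      where
      t≤length : ∀ {cs} → IsMatrix k t cs → t ≤ length cs
      t≤length (matrix _ _ l _) = subst (t ≤_) (sym l) t≤k

      remove : ∀ cs → T (Matrix (suc k) t cs ∧ not (nonzeroAt t cs)) → T (Matrix k t (removeAt t cs))
      remove cs p with isMatrix {suc k} {t} cs (∧-fst p)
      ... | matrix e s l pre = Matrix-intro {k} {t} (removeAt t cs) (matrix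
        (all-removeAt colAllowed t cs e)
        (trans (sym (total-insertAt-zeroCol t (removeAt t cs))) (trans (cong total restore) s))
        (ℕ.suc-injective (trans (sym (length-insertAt t (zeroCol m) (removeAt t cs))) (trans (cong length restore) l)))
        (T-subst (sym (nonzeroPrefix-removeAt t cs)) pre))
        where
        restore : insertAt t (zeroCol m) (removeAt t cs) ≡ cs
        restore = insertAt-removeAt-zero t cs (∧-snd {Matrix (suc k) t cs} p)

      insert : ∀ cs → T (Matrix k t cs) →
        T (Matrix (suc k) t (insertAt t (zeroCol m) cs) ∧ not (nonzeroAt t (insertAt t (zeroCol m) cs)))
      insert cs p with isMatrix {k} {t} cs p
      ... | matrix e s l pre = ∧-intro (Matrix-intro {suc k} {t} (insertAt t (zeroCol m) cs) (matrix
        (all-insertAt colAllowed t (zeroCol m) cs (colAllowed-zeroCol {m}) e)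
        (trans (total-insertAt-zeroCol t cs) s)
        (trans (length-insertAt t (zeroCol m) cs) (cong suc l))
        (T-subst (sym (nonzeroPrefix-insertAt t (zeroCol m) cs t≤cs)) pre)))
        (zero-at-insertAt t cs t≤cs)
        where t≤cs = t≤length (matrix e s l pre)

    Matrix-split : ∀ k t → t ≤ k →
      Sat (Matrix (suc k) t) ↔ (Sat (Matrix (suc k) (suc t)) ⊎ Sat (Matrix k t))
    Matrix-split k t t≤k =
      ↔-trans (Sat-split (Matrix (suc k) t) (nonzeroAt t)) (Sat-cong extend ⊎-↔ remove-zero-column k t t≤k)
      where
      extend : ∀ cs → Matrix (suc k) t cs ∧ nonzeroAt t cs ≡ Matrix (suc k) (suc t) cs
      extend cs =
        trans (∧-assoc₅ (all colAllowed cs) (total cs ≡ᵇ n) (length cs ≡ᵇ suc k) (nonzeroPrefix t cs) _)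
              (cong (λ b → all colAllowed cs ∧ (total cs ≡ᵇ n) ∧ (length cs ≡ᵇ suc k) ∧ b)
                    (sym (nonzeroPrefix-suc t cs)))

    flatten : List Col → List ℕ
    flatten []       = []
    flatten (c ∷ cs) = toList c ++ flatten cs

    -- Pads with zeros; it is only applied to lists that are long enough.
    takeCol : ∀ {l} → List ℕ → Vec ℕ l
    takeCol {zero}  _        = Vec.[]
    takeCol {suc l} []       = 0 Vec.∷ takeCol []
    takeCol {suc l} (x ∷ xs) = x Vec.∷ takeCol xs

    unflatten : ℕ → List ℕ → List Col
    unflatten zero    xs = []
    unflatten (suc k) xs = takeCol xs ∷ unflatten k (drop m xs)

    all-flatten : ∀ cs → all allowed (flatten cs) ≡ all colAllowed cs
    all-flatten []       = refl
    all-flatten (c ∷ cs) =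
      trans (all-++ allowed (toList c) (flatten cs)) (cong (colAllowed c ∧_) (all-flatten cs))

    sum-flatten : ∀ cs → sum (flatten cs) ≡ total cs
    sum-flatten []       = refl
    sum-flatten (c ∷ cs) = trans (sum-++ (toList c) (flatten cs)) (cong (colSum c +_) (sum-flatten cs))

    length-flatten : ∀ cs → length (flatten cs) ≡ m * length cs
    length-flatten []       = sym (ℕ.*-zeroʳ m)
    length-flatten (c ∷ cs) =
      trans (length-++ (toList c))
            (trans (cong₂ _+_ (length-toList c) (length-flatten cs)) (sym (ℕ.*-suc m (length cs))))

    length-unflatten : ∀ k xs → length (unflatten k xs) ≡ k
    length-unflatten zero    xs = refl
    length-unflatten (suc k) xs = cong suc (length-unflatten k (drop m xs))

    unflatten-flatten : ∀ cs → unflatten (length cs) (flatten cs) ≡ cs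
    unflatten-flatten []       = refl
    unflatten-flatten (c ∷ cs) =
      cong₂ _∷_ (takeCol-++ c (flatten cs))
                (trans (cong (unflatten (length cs)) (drop-toList-++ c (flatten cs))) (unflatten-flatten cs))
      where
      takeCol-++ : ∀ {l} (c : Vec ℕ l) r → takeCol (toList c ++ r) ≡ c
      takeCol-++ Vec.[]       r = refl
      takeCol-++ (x Vec.∷ c) r = cong (x Vec.∷_) (takeCol-++ c r)
      drop-toList-++ : ∀ {l} (c : Vec ℕ l) r → drop l (toList c ++ r) ≡ r
      drop-toList-++ Vec.[]       r = refl
      drop-toList-++ (x Vec.∷ c) r = drop-toList-++ c r

    flatten-unflatten : ∀ k xs → length xs ≡ m * k → flatten (unflatten k xs) ≡ xs
    flatten-unflatten zero    []       _ = refl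
    flatten-unflatten zero    (x ∷ xs) e = ⊥-elim (ℕ.1+n≢0 (trans e (ℕ.*-zeroʳ m)))
    flatten-unflatten (suc k) xs e =
      trans (cong (toList (takeCol {m} xs) ++_) (flatten-unflatten k (drop m xs) rest))
            (takeCol++drop m xs m≤length)
      where
      takeCol++drop : ∀ l xs → l ≤ length xs → toList (takeCol {l} xs) ++ drop l xs ≡ xs
      takeCol++drop zero    xs       _       = refl
      takeCol++drop (suc l) (x ∷ xs) (s≤s l≤) = cong (x ∷_) (takeCol++drop l xs l≤)
      length≡ : length xs ≡ m + m * k
      length≡ = trans e (ℕ.*-suc m k)
      m≤length : m ≤ length xs
      m≤length = subst (m ≤_) (sym length≡) (ℕ.m≤m+n m (m * k))
      rest : length (drop m xs) ≡ m * k
      rest = trans (length-drop m xs) (trans (cong (_∸ m) length≡) (ℕ.m+n∸m≡n m (m * k)))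

    Matrix-base : ∀ k → Sat (Matrix k 0) ↔ Sat (IsComposition allowed (m * k) n)
    Matrix-base k = Sat-↔ flatten (unflatten k) flat unflat
      (λ cs p → trans (cong (λ l → unflatten l (flatten cs)) (sym (IsMatrix.length≡ (isMatrix {k} {0} cs p))))
                      (unflatten-flatten cs))
      (λ xs p → flatten-unflatten k xs (≡ᵇ⇒≡ _ _ (∧-snd {sum xs ≡ᵇ n} (∧-snd {all allowed xs} p))))
      where
      flat : ∀ cs → T (Matrix k 0 cs) → T (IsComposition allowed (m * k) n (flatten cs))
      flat cs p with isMatrix {k} {0} cs p
      ... | matrix e s l _ = ∧-intro (T-subst (sym (all-flatten cs)) e)
        (∧-intro (≡⇒≡ᵇ _ _ (trans (sum-flatten cs) s))
                 (≡⇒≡ᵇ _ _ (trans (length-flatten cs) (cong (m *_) l))))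
      unflat : ∀ xs → T (IsComposition allowed (m * k) n xs) → T (Matrix k 0 (unflatten k xs))
      unflat xs p = Matrix-intro {k} {0} (unflatten k xs) (matrix
        (T-subst (trans (cong (all allowed) (sym fu)) (all-flatten (unflatten k xs))) (∧-fst p))
        (trans (sym (sum-flatten (unflatten k xs))) (trans (cong sum fu) (≡ᵇ⇒≡ _ _ (∧-fst q))))
        (length-unflatten k xs)
        tt)
        where
        q = ∧-snd {all allowed xs} p
        fu : flatten (unflatten k xs) ≡ xs
        fu = flatten-unflatten k xs (≡ᵇ⇒≡ _ _ (∧-snd {sum xs ≡ᵇ n} q))

    nonzeroPrefix-all : ∀ {k} cs → length cs ≡ k → nonzeroPrefix k cs ≡ all nonzeroColᵇ cs
    nonzeroPrefix-all []       refl = refl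
    nonzeroPrefix-all (c ∷ cs) refl = cong (nonzeroColᵇ c ∧_) (nonzeroPrefix-all cs refl)

    length≤total : ∀ cs → T (all nonzeroColᵇ cs) → length cs ≤ total cs
    length≤total []       _ = z≤n
    length≤total (c ∷ cs) p =
      ℕ.+-mono-≤ (nonzero⇒positive c (∧-fst p)) (length≤total cs (∧-snd {nonzeroColᵇ c} p))
      where
      nonzero⇒positive : ∀ {l} (c : Vec ℕ l) → T (nonzeroColᵇ c) → 1 ≤ colSum c
      nonzero⇒positive (zero  Vec.∷ c) p = nonzero⇒positive c p
      nonzero⇒positive (suc x Vec.∷ c) _ = s≤s z≤n

    NoZeroColumn : List Col → Bool
    NoZeroColumn cs = all nonzeroColᵇ cs ∧ all colAllowed cs ∧ (total cs ≡ᵇ n)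

    NoZeroColumn-card : (count : ℕ → ℕ) → (∀ L → Sat (IsComposition allowed L n) ↔ Fin (count L)) →
      HasCard (Sat NoZeroColumn) (sumTo n (inclusionExclusion (λ j → count (m * j))))
    NoZeroColumn-card count comp-card =
      HasCard-≡ (sym (sumTo≡sumBelow n (inclusionExclusion F)))
                (HasCard-fibres NoZeroColumn length (suc n) _ bound fibre)
      where
      F : ℕ → ℕ
      F k = count (m * k)

      open InclusionExclusion (λ k t → Sat (Matrix k t)) F
                              (λ k → ↔-trans (Matrix-base k) (comp-card (m * k))) Matrix-split

      bound : ∀ cs → T (NoZeroColumn cs) → length cs < suc n
      bound cs p = s≤s (subst (length cs ≤_) (≡ᵇ⇒≡ _ _ total≡n) (length≤total cs (∧-fst p)))
        where total≡n = ∧-snd {all colAllowed cs} (∧-snd {all nonzeroColᵇ cs} p)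

      fibre : ∀ k → k < suc n → HasCard (Sat (λ cs → NoZeroColumn cs ∧ (length cs ≡ᵇ k))) _
      fibre k _ = HasCard-↔ (Sat-⇔ to from) (W-card-diagonal k)
        where
        to : ∀ cs → T (NoZeroColumn cs ∧ (length cs ≡ᵇ k)) → T (Matrix k k cs)
        to cs p = Matrix-intro {k} {k} cs
          (matrix (∧-fst rest) (≡ᵇ⇒≡ _ _ (∧-snd {all colAllowed cs} rest)) l
                  (T-subst (sym (nonzeroPrefix-all cs l)) (∧-fst (∧-fst p))))
          where
          rest = ∧-snd {all nonzeroColᵇ cs} (∧-fst p)
          l = ≡ᵇ⇒≡ _ _ (∧-snd {NoZeroColumn cs} p)
        from : ∀ cs → T (Matrix k k cs) → T (NoZeroColumn cs ∧ (length cs ≡ᵇ k))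
        from cs p with isMatrix {k} {k} cs p
        ... | matrix e s l pre =
          ∧-intro (∧-intro (T-subst (nonzeroPrefix-all cs l) pre) (∧-intro e (≡⇒≡ᵇ _ _ s))) (≡⇒≡ᵇ _ _ l)

  matrices-card : ∀ m n → HasCard (G m n) (sumTo n (inclusionExclusion (λ j → multichoose (m * j) n)))
  matrices-card m n = HasCard-↔ (Sat-⇔ add-entries drop-entries)
                                (NoZeroColumn-card (λ L → multichoose L n) (λ L → weak-compositions-card L n))
    where
    open MatrixFamily m n (λ _ → true) tt
    add-entries : ∀ cs → T (all nonzeroColᵇ cs ∧ (total cs ≡ᵇ n)) → T (NoZeroColumn cs)
    add-entries cs p = ∧-intro {all nonzeroColᵇ cs} (∧-fst p)
      (∧-intro (all-true (λ c → all-true (λ _ → tt) (toList c)) cs) (∧-snd {all nonzeroColᵇ cs} p))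
    drop-entries : ∀ cs → T (NoZeroColumn cs) → T (all nonzeroColᵇ cs ∧ (total cs ≡ᵇ n))
    drop-entries cs p =
      ∧-intro {all nonzeroColᵇ cs} (∧-fst p) (∧-snd {all colAllowed cs} (∧-snd {all nonzeroColᵇ cs} p))

  binary-matrices-card : ∀ m n → HasCard (G01 m n) (sumTo n (inclusionExclusion (λ j → (m * j) C n)))
  binary-matrices-card m n = MatrixFamily.NoZeroColumn-card m n (_≤ᵇ 1) tt (_C n) (λ L → binary-compositions-card L n)

module Relabelling where

  open Subtypes
  open import Defs using (elemᵇ)
  open import Data.Bool using (Bool; true; false; _∧_; _∨_; not; T)
  open import Data.Bool.ListAction using (all)
  open import Data.Nat as ℕ using (ℕ; zero; suc; _≤_; _<_; z≤n; s≤s; _≡ᵇ_; _≤ᵇ_; _<ᵇ_)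
  open import Data.Nat.Properties as ℕ using (≤ᵇ⇒≤; ≤⇒≤ᵇ)
  open import Data.List using (List; []; _∷_; map)
  open import Data.Product using (_×_; _,_)
  open import Data.Unit using (tt)
  open import Relation.Nullary using (yes; no)
  open import Relation.Binary.PropositionalEquality

  -- squeeze t removes the value t+1 (values above it move down by one); stretch t is its inverse
  -- onto values different from t+1.
  squeeze : ℕ → ℕ → ℕ
  squeeze t       zero    = zero
  squeeze zero    (suc x) = x
  squeeze (suc t) (suc x) = suc (squeeze t x)

  stretch : ℕ → ℕ → ℕ
  stretch t       zero    = zero
  stretch zero    (suc y) = suc (suc y)
  stretch (suc t) (suc y) = suc (stretch t y)

  squeeze-stretch : ∀ t y → squeeze t (stretch t y) ≡ y
  squeeze-stretch t       zero    = refl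
  squeeze-stretch zero    (suc y) = refl
  squeeze-stretch (suc t) (suc y) = cong suc (squeeze-stretch t y)

  stretch-squeeze : ∀ t x → suc t ≢ᵇ x → stretch t (squeeze t x) ≡ x
  stretch-squeeze t       zero          _ = refl
  stretch-squeeze zero    (suc (suc x)) _ = refl
  stretch-squeeze (suc t) (suc x)       p = cong suc (stretch-squeeze t x p)

  stretch-avoids : ∀ t y → suc t ≢ᵇ stretch t y
  stretch-avoids t       zero    = tt
  stretch-avoids zero    (suc y) = tt
  stretch-avoids (suc t) (suc y) = stretch-avoids t y

  SqueezeInvariant : (ℕ → ℕ → Bool) → Set
  SqueezeInvariant rel = ∀ t x y → suc t ≢ᵇ x → suc t ≢ᵇ y → rel (squeeze t x) (squeeze t y) ≡ rel x y

  squeeze-<ᵇ : SqueezeInvariant _<ᵇ_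
  squeeze-<ᵇ t       zero          zero          _ _ = refl
  squeeze-<ᵇ zero    zero          (suc (suc y)) _ _ = refl
  squeeze-<ᵇ (suc t) zero          (suc y)       _ _ = refl
  squeeze-<ᵇ zero    (suc (suc x)) zero          _ _ = refl
  squeeze-<ᵇ (suc t) (suc x)       zero          _ _ = refl
  squeeze-<ᵇ zero    (suc (suc x)) (suc (suc y)) _ _ = refl
  squeeze-<ᵇ (suc t) (suc x)       (suc y)       p q = squeeze-<ᵇ t x y p q

  <ᵇ-suc : ∀ a b → (a <ᵇ suc b) ≡ (a ≤ᵇ b)
  <ᵇ-suc zero    b = refl
  <ᵇ-suc (suc a) b = refl

  squeeze-≤ᵇ : SqueezeInvariant _≤ᵇ_
  squeeze-≤ᵇ t       zero          y             _ _ = refl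
  squeeze-≤ᵇ zero    (suc (suc x)) zero          _ _ = refl
  squeeze-≤ᵇ (suc t) (suc x)       zero          _ _ = refl
  squeeze-≤ᵇ zero    (suc (suc x)) (suc (suc y)) _ _ = refl
  squeeze-≤ᵇ (suc t) (suc x)       (suc y)       p q =
    trans (<ᵇ-suc (squeeze t x) (squeeze t y)) (trans (squeeze-≤ᵇ t x y p q) (sym (<ᵇ-suc x y)))

  squeeze-≡ᵇ : ∀ t j x → j ≤ t → suc t ≢ᵇ x → (j ≡ᵇ squeeze t x) ≡ (j ≡ᵇ x)
  squeeze-≡ᵇ t       j       zero          _         _ = refl
  squeeze-≡ᵇ zero    zero    (suc (suc x)) _         _ = refl
  squeeze-≡ᵇ (suc t) zero    (suc x)       _         _ = refl
  squeeze-≡ᵇ (suc t) (suc j) (suc x)       (s≤s j≤t) p = squeeze-≡ᵇ t j x j≤t p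

  squeeze-below : ∀ t x → x ≤ t → squeeze t x ≡ x
  squeeze-below t       zero    _         = refl
  squeeze-below (suc t) (suc x) (s≤s x≤t) = cong suc (squeeze-below t x x≤t)

  squeeze-above : ∀ t x → suc t < x → suc (squeeze t x) ≡ x
  squeeze-above zero    (suc zero)    (s≤s ())
  squeeze-above zero    (suc (suc x)) _         = refl
  squeeze-above (suc t) (suc x)       (s≤s t<x) = cong suc (squeeze-above t x t<x)

  stretch-below : ∀ t y → y ≤ t → stretch t y ≡ y
  stretch-below t       zero    _         = refl
  stretch-below (suc t) (suc y) (s≤s y≤t) = cong suc (stretch-below t y y≤t)

  stretch-above : ∀ t y → t < y → stretch t y ≡ suc y
  stretch-above zero    (suc y) _         = refl
  stretch-above (suc t) (suc y) (s≤s t<y) = cong suc (stretch-above t y t<y)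

  inRange : ℕ → ℕ → Bool
  inRange k x = (1 ≤ᵇ x) ∧ (x ≤ᵇ k)

  inRange-intro : ∀ {k x} → 1 ≤ x → x ≤ k → T (inRange k x)
  inRange-intro 1≤x x≤k = ∧-intro (≤⇒≤ᵇ 1≤x) (≤⇒≤ᵇ x≤k)

  inRange-pos : ∀ {k} x → T (inRange k x) → 1 ≤ x
  inRange-pos x p = ≤ᵇ⇒≤ 1 x (∧-fst p)

  inRange-≤ : ∀ {k} x → T (inRange k x) → x ≤ k
  inRange-≤ {k} x p = ≤ᵇ⇒≤ x k (∧-snd {1 ≤ᵇ x} p)

  inRange-suc : ∀ {k} x → T (inRange k x) → T (inRange (suc k) x)
  inRange-suc x p = inRange-intro (inRange-pos x p) (ℕ.m≤n⇒m≤1+n (inRange-≤ x p))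

  inRange-top : ∀ k → T (inRange (suc k) (suc k))
  inRange-top k = inRange-intro {suc k} (s≤s z≤n) ℕ.≤-refl

  all-inRange-suc : ∀ k xs → T (all (inRange k) xs) → T (all (inRange (suc k)) xs)
  all-inRange-suc k []       _ = tt
  all-inRange-suc k (x ∷ xs) p = ∧-intro (inRange-suc x (∧-fst p)) (all-inRange-suc k xs (∧-snd {inRange k x} p))

  squeeze-inRange : ∀ t k x → t ≤ k → suc t ≢ᵇ x → T (inRange (suc k) x) →
    T (inRange k (squeeze t x))
  squeeze-inRange t k x t≤k x≢ p with x ℕ.≤? t
  ... | yes x≤t rewrite squeeze-below t x x≤t = inRange-intro (inRange-pos x p) (ℕ.≤-trans x≤t t≤k)
  ... | no  x≰t = inRange-intro (ℕ.≤-trans (s≤s z≤n) (ℕ.≤-pred t+2≤))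
                               (ℕ.≤-pred (subst (_≤ suc k) (sym above) (inRange-≤ x p)))
    where
    t+1<x : suc t < x
    t+1<x = ℕ.≤∧≢⇒< (ℕ.≰⇒> x≰t) (≢ᵇ⇒≢ (suc t) x x≢)
    above : suc (squeeze t x) ≡ x
    above = squeeze-above t x t+1<x
    t+2≤ : suc (suc t) ≤ suc (squeeze t x)
    t+2≤ = subst (suc (suc t) ≤_) (sym above) t+1<x

  stretch-inRange : ∀ t k y → t ≤ k → T (inRange k y) → T (inRange (suc k) (stretch t y))
  stretch-inRange t k y t≤k p with y ℕ.≤? t
  ... | yes y≤t rewrite stretch-below t y y≤t = inRange-suc y p
  ... | no  y≰t rewrite stretch-above t y (ℕ.≰⇒> y≰t) =
    inRange-intro (s≤s z≤n) (s≤s (inRange-≤ y p))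

  not-∨ : ∀ {a b} → T (not (a ∨ b)) → T (not a) × T (not b)
  not-∨ {false} {false} _ = tt , tt

  usesUpTo : ℕ → List ℕ → Bool
  usesUpTo zero    xs = true
  usesUpTo (suc t) xs = usesUpTo t xs ∧ elemᵇ (suc t) xs

  module _ (t : ℕ) where

    Avoids : List ℕ → Set
    Avoids xs = T (not (elemᵇ (suc t) xs))

    stretch-squeeze-list : ∀ xs → Avoids xs → map (stretch t) (map (squeeze t) xs) ≡ xs
    stretch-squeeze-list []       _ = refl
    stretch-squeeze-list (x ∷ xs) p with not-∨ {suc t ≡ᵇ x} p
    ... | px , pxs = cong₂ _∷_ (stretch-squeeze t x px) (stretch-squeeze-list xs pxs)

    squeeze-stretch-list : ∀ ys → map (squeeze t) (map (stretch t) ys) ≡ ys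
    squeeze-stretch-list []       = refl
    squeeze-stretch-list (y ∷ ys) = cong₂ _∷_ (squeeze-stretch t y) (squeeze-stretch-list ys)

    stretch-list-avoids : ∀ ys → Avoids (map (stretch t) ys)
    stretch-list-avoids []       = tt
    stretch-list-avoids (y ∷ ys) with suc t ≡ᵇ stretch t y | stretch-avoids t y
    ... | false | _ = stretch-list-avoids ys

    squeeze-elemᵇ : ∀ j xs → j ≤ t → Avoids xs → elemᵇ j (map (squeeze t) xs) ≡ elemᵇ j xs
    squeeze-elemᵇ j []       _   _ = refl
    squeeze-elemᵇ j (x ∷ xs) j≤t p with not-∨ {suc t ≡ᵇ x} p
    ... | px , pxs = cong₂ _∨_ (squeeze-≡ᵇ t j x j≤t px) (squeeze-elemᵇ j xs j≤t pxs)

    squeeze-usesUpTo : ∀ s xs → s ≤ t → Avoids xs → usesUpTo s (map (squeeze t) xs) ≡ usesUpTo s xs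
    squeeze-usesUpTo zero    xs _   _ = refl
    squeeze-usesUpTo (suc s) xs s<t p =
      cong₂ _∧_ (squeeze-usesUpTo s xs (ℕ.≤-trans (ℕ.n≤1+n s) s<t) p) (squeeze-elemᵇ (suc s) xs s<t p)

    squeeze-inRange-list : ∀ k xs → t ≤ k → Avoids xs → T (all (inRange (suc k)) xs) →
      T (all (inRange k) (map (squeeze t) xs))
    squeeze-inRange-list k []       _   _ _ = tt
    squeeze-inRange-list k (x ∷ xs) t≤k p q with not-∨ {suc t ≡ᵇ x} p
    ... | px , pxs = ∧-intro (squeeze-inRange t k x t≤k px (∧-fst q))
                             (squeeze-inRange-list k xs t≤k pxs (∧-snd {inRange (suc k) x} q))

    stretch-inRange-list : ∀ k ys → t ≤ k → T (all (inRange k) ys) →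
      T (all (inRange (suc k)) (map (stretch t) ys))
    stretch-inRange-list k []       _   _ = tt
    stretch-inRange-list k (y ∷ ys) t≤k q =
      ∧-intro (stretch-inRange t k y t≤k (∧-fst q)) (stretch-inRange-list k ys t≤k (∧-snd {inRange k y} q))


module CayleyWords where

  open Subtypes
  open Relabelling
  open import Defs using (elemᵇ; ascPos; subsetᵇ)
  open import Data.Bool using (Bool; _∧_; not; T; if_then_else_)
  open import Data.Bool.ListAction using (all)
  open import Data.Nat as ℕ using (ℕ; suc; _≤_; _≡ᵇ_)
  open import Data.Nat.Properties as ℕ using (≡ᵇ⇒≡; ≡⇒≡ᵇ)
  open import Data.List using (List; []; _∷_; length; map)
  open import Data.List.Properties using (length-map)
  open import Data.Product using (proj₁; proj₂)
  open import Data.Sum using (_⊎_)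
  open import Function.Bundles using (_↔_)
  open import Function.Properties.Inverse using (↔-trans)
  open import Data.Sum.Function.Propositional using (_⊎-↔_)
  open import Relation.Binary.PropositionalEquality

  module WordFamily (n : ℕ) (S : List ℕ) (rel : ℕ → ℕ → Bool)
    (rel-squeeze : SqueezeInvariant rel) where

    ascentsIn : List ℕ → Bool
    ascentsIn xs = subsetᵇ (ascPos rel 1 xs) S

    Word : ℕ → ℕ → List ℕ → Bool
    Word k t xs = (length xs ≡ᵇ n) ∧ all (inRange k) xs ∧ ascentsIn xs ∧ usesUpTo t xs

    record IsWord (k t : ℕ) (xs : List ℕ) : Set where
      constructor word
      field
        length≡ : length xs ≡ n
        values  : T (all (inRange k) xs)
        ascents : T (ascentsIn xs)
        uses    : T (usesUpTo t xs)

    isWord : ∀ k t xs → T (Word k t xs) → IsWord k t xs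
    isWord k t xs p = word (≡ᵇ⇒≡ _ _ (∧-fst p)) (∧-fst q) (∧-fst r) (∧-snd {ascentsIn xs} r)
      where
      q = ∧-snd {length xs ≡ᵇ n} p
      r = ∧-snd {all (inRange k) xs} q

    Word-intro : ∀ k t xs → IsWord k t xs → T (Word k t xs)
    Word-intro k t xs (word l v a u) = ∧-intro (≡⇒≡ᵇ _ _ l) (∧-intro v (∧-intro a u))

    ascPos-squeeze : ∀ t i xs → Avoids t xs → ascPos rel i (map (squeeze t) xs) ≡ ascPos rel i xs
    ascPos-squeeze t i []           _ = refl
    ascPos-squeeze t i (x ∷ [])     _ = refl
    ascPos-squeeze t i (x ∷ y ∷ ys) p =
      cong₂ (λ b R → if b then i ∷ R else R)
            (rel-squeeze t x y (proj₁ (not-∨ {suc t ≡ᵇ x} p)) (proj₁ (not-∨ {suc t ≡ᵇ y} pys)))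
            (ascPos-squeeze t (suc i) (y ∷ ys) pys)
      where pys = proj₂ (not-∨ {suc t ≡ᵇ x} p)

    squeeze-ascentsIn : ∀ t xs → Avoids t xs → ascentsIn (map (squeeze t) xs) ≡ ascentsIn xs
    squeeze-ascentsIn t xs p = cong (λ l → subsetᵇ l S) (ascPos-squeeze t 1 xs p)

    stretch-ascentsIn : ∀ t ys → ascentsIn (map (stretch t) ys) ≡ ascentsIn ys
    stretch-ascentsIn t ys =
      trans (sym (squeeze-ascentsIn t (map (stretch t) ys) (stretch-list-avoids t ys)))
            (cong ascentsIn (squeeze-stretch-list t ys))

    stretch-usesUpTo : ∀ t ys → usesUpTo t (map (stretch t) ys) ≡ usesUpTo t ys
    stretch-usesUpTo t ys =
      trans (sym (squeeze-usesUpTo t t (map (stretch t) ys) ℕ.≤-refl (stretch-list-avoids t ys)))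
            (cong (usesUpTo t) (squeeze-stretch-list t ys))

    remove-unused-value : ∀ k t → t ≤ k →
      Sat (λ xs → Word (suc k) t xs ∧ not (elemᵇ (suc t) xs)) ↔ Sat (Word k t)
    remove-unused-value k t t≤k = Sat-↔ (map (squeeze t)) (map (stretch t)) squeezed stretched
      (λ xs p → stretch-squeeze-list t xs (∧-snd {Word (suc k) t xs} p)) (λ ys _ → squeeze-stretch-list t ys)
      where
      squeezed : ∀ xs → T (Word (suc k) t xs ∧ not (elemᵇ (suc t) xs)) →
        T (Word k t (map (squeeze t) xs))
      squeezed xs p with isWord (suc k) t xs (∧-fst p) | ∧-snd {Word (suc k) t xs} p
      ... | word l v a u | avoids = Word-intro k t (map (squeeze t) xs) (word
        (trans (length-map (squeeze t) xs) l)
        (squeeze-inRange-list t k xs t≤k avoids v)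
        (T-subst (sym (squeeze-ascentsIn t xs avoids)) a)
        (T-subst (sym (squeeze-usesUpTo t t xs ℕ.≤-refl avoids)) u))

      stretched : ∀ ys → T (Word k t ys) →
        T (Word (suc k) t (map (stretch t) ys) ∧ not (elemᵇ (suc t) (map (stretch t) ys)))
      stretched ys p with isWord k t ys p
      ... | word l v a u = ∧-intro (Word-intro (suc k) t (map (stretch t) ys) (word
        (trans (length-map (stretch t) ys) l)
        (stretch-inRange-list t k ys t≤k v)
        (T-subst (sym (stretch-ascentsIn t ys)) a)
        (T-subst (sym (stretch-usesUpTo t ys)) u)))
        (stretch-list-avoids t ys)

    Word-split : ∀ k t → t ≤ k → Sat (Word (suc k) t) ↔ (Sat (Word (suc k) (suc t)) ⊎ Sat (Word k t))
    Word-split k t t≤k =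
      ↔-trans (Sat-split (Word (suc k) t) (elemᵇ (suc t))) (Sat-cong extend ⊎-↔ remove-unused-value k t t≤k)
      where
      extend : ∀ xs → Word (suc k) t xs ∧ elemᵇ (suc t) xs ≡ Word (suc k) (suc t) xs
      extend xs = ∧-assoc₅ (length xs ≡ᵇ n) (all (inRange (suc k)) xs) (ascentsIn xs) (usesUpTo t xs) _


module DescendingWords where

  open Subtypes
  open Compositions using (tail; multichoose-pascal)
  open Relabelling using (inRange; inRange-intro; inRange-pos; inRange-≤; inRange-top; all-inRange-suc)
  open import Defs using (multichoose)
  open import Data.Bool using (Bool; true; false; _∧_; not; T)
  open import Data.Bool.ListAction using (all)
  open import Data.Nat as ℕ using (ℕ; zero; suc; _≤_; _<_; s≤s; _≡ᵇ_; _≤ᵇ_; _<ᵇ_)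
  open import Data.Nat.Properties as ℕ using (≡ᵇ⇒≡; ≡⇒≡ᵇ; ≤⇒≤ᵇ; <⇒<ᵇ)
  open import Data.Nat.Combinatorics using (_C_; nCk+nC[k+1]≡[n+1]C[k+1])
  open import Data.List using (List; []; _∷_; length)
  open import Data.Fin using (Fin)
  open import Data.Empty using (⊥)
  open import Data.Unit using (tt)
  open import Function.Bundles using (_↔_)
  open import Function.Properties.Inverse using (↔-trans)
  open import Relation.Binary.PropositionalEquality

  headIs : ℕ → List ℕ → Bool
  headIs k []      = false
  headIs k (x ∷ _) = x ≡ᵇ k

  NonAscent⇒≥ : (ℕ → ℕ → Bool) → Set
  NonAscent⇒≥ rel = ∀ x y → T (not (rel x y)) → y ≤ x

  module Descending (rel : ℕ → ℕ → Bool) (no-rel⇒≥ : NonAscent⇒≥ rel) where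

    noAscent : List ℕ → Bool
    noAscent []           = true
    noAscent (x ∷ [])     = true
    noAscent (x ∷ y ∷ ys) = not (rel x y) ∧ noAscent (y ∷ ys)

    noAscent-tail : ∀ xs → T (noAscent xs) → T (noAscent (tail xs))
    noAscent-tail []           _ = tt
    noAscent-tail (x ∷ [])     _ = tt
    noAscent-tail (x ∷ y ∷ ys) p = ∧-snd {not (rel x y)} p

    Desc : ℕ → ℕ → List ℕ → Bool
    Desc k L xs = (length xs ≡ᵇ L) ∧ all (inRange k) xs ∧ noAscent xs

    record IsDesc (k L : ℕ) (xs : List ℕ) : Set where
      constructor desc
      field
        length≡  : length xs ≡ L
        values   : T (all (inRange k) xs)
        noAsc    : T (noAscent xs)

    isDesc : ∀ k L xs → T (Desc k L xs) → IsDesc k L xs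
    isDesc k L xs p = desc (≡ᵇ⇒≡ _ _ (∧-fst p)) (∧-fst q) (∧-snd {all (inRange k) xs} q)
      where q = ∧-snd {length xs ≡ᵇ L} p

    Desc-intro : ∀ k L xs → IsDesc k L xs → T (Desc k L xs)
    Desc-intro k L xs (desc l v d) = ∧-intro (≡⇒≡ᵇ _ _ l) (∧-intro v d)

    bounded-by-head : ∀ k x xs → x ≤ k → T (noAscent (x ∷ xs)) → T (all (inRange (suc k)) (x ∷ xs)) →
      T (all (inRange k) (x ∷ xs))
    bounded-by-head k x []       x≤k _ p = ∧-intro (inRange-intro (inRange-pos x (∧-fst p)) x≤k) tt
    bounded-by-head k x (y ∷ ys) x≤k d p =
      ∧-intro (inRange-intro (inRange-pos x (∧-fst p)) x≤k)
              (bounded-by-head k y ys (ℕ.≤-trans (no-rel⇒≥ x y (∧-fst d)) x≤k)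
                               (∧-snd {not (rel x y)} d) (∧-snd {inRange (suc k) x} p))

    Desc-length-0 : ∀ k → Sat (Desc k 0) ↔ Fin 1
    Desc-length-0 k = Sat-unique [] tt (λ { [] _ → refl })

    Desc-range-0 : ∀ L → Sat (Desc 0 (suc L)) ↔ Fin 0
    Desc-range-0 L = Sat-empty no-value
      where
      no-value : ∀ xs → T (Desc 0 (suc L) xs) → ⊥
      no-value (x ∷ xs) p with ∧-fst {inRange 0 x} (∧-fst (∧-snd {length xs ≡ᵇ L} p))
      ... | q = ℕ.<-irrefl refl (ℕ.≤-trans (inRange-pos x q) (inRange-≤ x q))

    head-below-top : ∀ k L →
      Sat (λ xs → Desc (suc k) (suc L) xs ∧ not (headIs (suc k) xs)) ↔ Sat (Desc k (suc L))
    head-below-top k L = Sat-⇔ lower raise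
      where
      lower : ∀ xs → T (Desc (suc k) (suc L) xs ∧ not (headIs (suc k) xs)) → T (Desc k (suc L) xs)
      lower (x ∷ xs) p with isDesc (suc k) (suc L) (x ∷ xs) (∧-fst p)
      ... | desc l v d = Desc-intro k (suc L) (x ∷ xs) (desc l (bounded-by-head k x xs x≤k d v) d)
        where
        x≤k : x ≤ k
        x≤k = ℕ.≤-pred (ℕ.≤∧≢⇒< (inRange-≤ x (∧-fst v))
                                 (≢ᵇ⇒≢ x (suc k) (∧-snd {Desc (suc k) (suc L) (x ∷ xs)} p)))
      raise : ∀ xs → T (Desc k (suc L) xs) → T (Desc (suc k) (suc L) xs ∧ not (headIs (suc k) xs))
      raise (x ∷ xs) p with isDesc k (suc L) (x ∷ xs) p
      ... | desc l v d = ∧-intro (Desc-intro (suc k) (suc L) (x ∷ xs) (desc l (all-inRange-suc k (x ∷ xs) v) d))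
                                 (≢⇒≢ᵇ x (suc k) (λ e → ℕ.<-irrefl e (s≤s (inRange-≤ x (∧-fst v)))))

    head-top : ∀ k k′ L → (∀ ys → T (Desc (suc k) (suc L) (suc k ∷ ys)) → T (Desc k′ L ys))
                        → (∀ ys → T (Desc k′ L ys) → T (Desc (suc k) (suc L) (suc k ∷ ys)))
      → Sat (λ xs → Desc (suc k) (suc L) xs ∧ headIs (suc k) xs) ↔ Sat (Desc k′ L)
    head-top k k′ L drop-top add-top =
      Sat-↔ tail (suc k ∷_) untop (λ ys p → ∧-intro (add-top ys p) (≡⇒≡ᵇ (suc k) (suc k) refl))
            cons-tail (λ _ _ → refl)
      where
      top≡ : ∀ x xs → T (Desc (suc k) (suc L) (x ∷ xs) ∧ headIs (suc k) (x ∷ xs)) → x ≡ suc k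
      top≡ x xs p = ≡ᵇ⇒≡ x (suc k) (∧-snd {Desc (suc k) (suc L) (x ∷ xs)} p)
      untop : ∀ xs → T (Desc (suc k) (suc L) xs ∧ headIs (suc k) xs) → T (Desc k′ L (tail xs))
      untop (x ∷ xs) p with top≡ x xs p
      ... | refl = drop-top xs (∧-fst p)
      cons-tail : ∀ xs → T (Desc (suc k) (suc L) xs ∧ headIs (suc k) xs) → suc k ∷ tail xs ≡ xs
      cons-tail (x ∷ xs) p = cong (_∷ xs) (sym (top≡ x xs p))

  ≤⇒not-<ᵇ : ∀ {k y} → y ≤ k → T (not (k <ᵇ y))
  ≤⇒not-<ᵇ {k} {y} y≤k = ¬T⇒T-not (λ p → ℕ.<⇒≱ (ℕ.<ᵇ⇒< k y p) y≤k)

  not-<ᵇ⇒≥ : NonAscent⇒≥ _<ᵇ_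
  not-<ᵇ⇒≥ x y p = ℕ.≮⇒≥ (λ x<y → T-not-contra (<⇒<ᵇ x<y) p)

  not-≤ᵇ⇒> : ∀ x y → T (not (x ≤ᵇ y)) → y < x
  not-≤ᵇ⇒> x y p = ℕ.≰⇒> (λ x≤y → T-not-contra (≤⇒≤ᵇ x≤y) p)

  not-≤ᵇ⇒≥ : NonAscent⇒≥ _≤ᵇ_
  not-≤ᵇ⇒≥ x y p = ℕ.<⇒≤ (not-≤ᵇ⇒> x y p)

  -- Words without strict ascents are weakly descending (counted by multichoose), words without weak
  -- ascents are strictly descending (counted by binomials).
  module Weak = Descending _<ᵇ_ not-<ᵇ⇒≥
  module Strict = Descending _≤ᵇ_ not-≤ᵇ⇒≥

  weakly-descending-card : ∀ k L → Sat (Weak.Desc k L) ↔ Fin (multichoose k L)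
  weakly-descending-card zero    zero    = Weak.Desc-length-0 0
  weakly-descending-card zero    (suc L) = Weak.Desc-range-0 L
  weakly-descending-card (suc k) zero    = Weak.Desc-length-0 (suc k)
  weakly-descending-card (suc k) (suc L) =
    ↔-trans (Sat-split (Desc (suc k) (suc L)) (headIs (suc k)))
    (↔-trans (⊎-Fin (↔-trans (head-top k (suc k) L drop-top add-top) (weakly-descending-card (suc k) L))
                    (↔-trans (head-below-top k L) (weakly-descending-card k (suc L))))
             (Fin-cast (trans (ℕ.+-comm (multichoose (suc k) L) _) (multichoose-pascal k L))))
    where
    open Weak
    drop-top : ∀ ys → T (Desc (suc k) (suc L) (suc k ∷ ys)) → T (Desc (suc k) L ys)
    drop-top ys p with isDesc (suc k) (suc L) (suc k ∷ ys) p
    ... | desc l v d =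
      Desc-intro (suc k) L ys (desc (ℕ.suc-injective l) (∧-snd {inRange (suc k) (suc k)} v) (noAscent-tail (suc k ∷ ys) d))
    add-top : ∀ ys → T (Desc (suc k) L ys) → T (Desc (suc k) (suc L) (suc k ∷ ys))
    add-top ys p with isDesc (suc k) L ys p
    ... | desc l v d =
      Desc-intro (suc k) (suc L) (suc k ∷ ys) (desc (cong suc l) (∧-intro (inRange-top k) v) (below-top ys v d))
      where
      below-top : ∀ ys → T (all (inRange (suc k)) ys) → T (noAscent ys) → T (noAscent (suc k ∷ ys))
      below-top []      _ _ = tt
      below-top (y ∷ _) v d = ∧-intro (≤⇒not-<ᵇ (inRange-≤ y (∧-fst v))) d

  strictly-descending-card : ∀ k L → Sat (Strict.Desc k L) ↔ Fin (k C L)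
  strictly-descending-card zero    zero    = Strict.Desc-length-0 0
  strictly-descending-card zero    (suc L) = Strict.Desc-range-0 L
  strictly-descending-card (suc k) zero    = Strict.Desc-length-0 (suc k)
  strictly-descending-card (suc k) (suc L) =
    ↔-trans (Sat-split (Desc (suc k) (suc L)) (headIs (suc k)))
    (↔-trans (⊎-Fin (↔-trans (head-top k k L drop-top add-top) (strictly-descending-card k L))
                    (↔-trans (head-below-top k L) (strictly-descending-card k (suc L))))
             (Fin-cast (nCk+nC[k+1]≡[n+1]C[k+1] k L)))
    where
    open Strict
    drop-top : ∀ ys → T (Desc (suc k) (suc L) (suc k ∷ ys)) → T (Desc k L ys)
    drop-top ys p with isDesc (suc k) (suc L) (suc k ∷ ys) p
    ... | desc l v d =
      Desc-intro k L ys
        (desc (ℕ.suc-injective l) (values ys (∧-snd {inRange (suc k) (suc k)} v) d) (noAscent-tail (suc k ∷ ys) d))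
      where
      values : ∀ ys → T (all (inRange (suc k)) ys) → T (noAscent (suc k ∷ ys)) → T (all (inRange k) ys)
      values []       _ _ = tt
      values (y ∷ ys) v d =
        bounded-by-head k y ys (ℕ.≤-pred (not-≤ᵇ⇒> (suc k) y (∧-fst d))) (∧-snd {not (suc k ≤ᵇ y)} d) v
    add-top : ∀ ys → T (Desc k L ys) → T (Desc (suc k) (suc L) (suc k ∷ ys))
    add-top ys p with isDesc k L ys p
    ... | desc l v d = Desc-intro (suc k) (suc L) (suc k ∷ ys)
        (desc (cong suc l) (∧-intro (inRange-top k) (all-inRange-suc k ys v)) (below-top ys v d))
      where
      below-top : ∀ ys → T (all (inRange k) ys) → T (noAscent ys) → T (noAscent (suc k ∷ ys))
      below-top []      _ _ = tt
      below-top (y ∷ _) v d = ∧-intro (≤⇒not-<ᵇ (inRange-≤ y (∧-fst v))) d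


module AscentBlocks where

  open Subtypes
  open Relabelling using (inRange)
  open DescendingWords using (NonAscent⇒≥; module Descending)
  open import Defs using (elemᵇ; ascPos; subsetᵇ; gaps; prodList; IsSubsetOfBracket; strictlyIncᵇ)
  open import Data.Bool using (Bool; true; false; _∧_; _∨_; not; T; if_then_else_)
  open import Data.Bool.Properties using (∧-assoc; ∨-identityʳ; ∨-zeroʳ)
  open import Data.Bool.ListAction using (all)
  open import Data.Nat as ℕ using (ℕ; suc; _+_; _∸_; _≤_; _<_; _≥_; z≤n; s≤s; _≡ᵇ_; _≤ᵇ_; _<ᵇ_)
  open import Data.Nat.Properties as ℕ using (≡ᵇ⇒≡; ≡⇒≡ᵇ; ≤ᵇ⇒≤; <ᵇ⇒<)
  open import Data.List using (List; []; _∷_; length; map; take; drop; _++_)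
  open import Data.List.Properties using (length-++; length-take; length-drop; take++drop≡id)
  open import Data.Product using (_×_; _,_)
  open import Data.Product.Function.NonDependent.Propositional using (_×-↔_)
  open import Data.Fin using (Fin)
  open import Data.Fin.Properties using (*↔×)
  open import Data.Empty using (⊥-elim)
  open import Data.Unit using (⊤; tt)
  open import Function.Bundles using (_↔_)
  open import Function.Properties.Inverse using (↔-sym; ↔-trans)
  open import Relation.Binary.PropositionalEquality

  Between : ℕ → ℕ → List ℕ → Set
  Between n prev []      = prev < n
  Between n prev (s ∷ S) = prev < s × Between n s S

  Between-< : ∀ n prev S → Between n prev S → prev < n
  Between-< n prev []      b         = b
  Between-< n prev (s ∷ S) (p<s , b) = ℕ.<-trans p<s (Between-< n s S b)

  Between-∉ : ∀ n s S → Between n s S → ∀ p → p ≤ s → elemᵇ p S ≡ false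
  Between-∉ n s []        _          p p≤s = refl
  Between-∉ n s (s′ ∷ S) (s<s′ , b) p p≤s = cong₂ _∨_
    (T-not⇒≡false (≢⇒≢ᵇ p s′ (λ e → ℕ.<-irrefl e (ℕ.≤-<-trans p≤s s<s′))))
    (Between-∉ n s′ S b p (ℕ.≤-trans p≤s (ℕ.<⇒≤ s<s′)))

  module _ (n : ℕ) where

    private
      inBracket : ℕ → Bool
      inBracket s = (1 ≤ᵇ s) ∧ (s <ᵇ n)

      HeadAbove : ℕ → List ℕ → Set
      HeadAbove prev []      = ⊤
      HeadAbove prev (s ∷ _) = prev < s

      between : ∀ prev S → prev < n → HeadAbove prev S → T (strictlyIncᵇ S) → T (all inBracket S) →
        Between n prev S
      between prev []           prev<n _      _   _ = prev<n
      between prev (s ∷ [])     _      prev<s _   b = prev<s , <ᵇ⇒< s n (∧-snd {1 ≤ᵇ s} (∧-fst b))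
      between prev (s ∷ s′ ∷ S) _      prev<s inc b =
        prev<s , between s (s′ ∷ S) (<ᵇ⇒< s n (∧-snd {1 ≤ᵇ s} (∧-fst b))) (<ᵇ⇒< s s′ (∧-fst inc))
                                    (∧-snd {s <ᵇ s′} inc) (∧-snd {inBracket s} b)

      first-positive : ∀ S → T (all inBracket S) → HeadAbove 0 S
      first-positive []      _ = tt
      first-positive (s ∷ _) b = ≤ᵇ⇒≤ 1 s (∧-fst (∧-fst b))

    bracket⇒Between : n ≥ 1 → ∀ S → IsSubsetOfBracket n S → Between n 0 S
    bracket⇒Between n≥1 S p =
      between 0 S n≥1 (first-positive S (∧-snd {strictlyIncᵇ S} p)) (∧-fst p) (∧-snd {strictlyIncᵇ S} p)

  module Segments (rel : ℕ → ℕ → Bool) (no-rel⇒≥ : NonAscent⇒≥ rel) where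

    open Descending rel no-rel⇒≥

    ascentsWithin : ℕ → List ℕ → List ℕ → Bool
    ascentsWithin i S []           = true
    ascentsWithin i S (x ∷ [])     = true
    ascentsWithin i S (x ∷ y ∷ ys) = (not (rel x y) ∨ elemᵇ i S) ∧ ascentsWithin (suc i) S (y ∷ ys)

    subsetᵇ-ascPos : ∀ i S xs → subsetᵇ (ascPos rel i xs) S ≡ ascentsWithin i S xs
    subsetᵇ-ascPos i S []           = refl
    subsetᵇ-ascPos i S (x ∷ [])     = refl
    subsetᵇ-ascPos i S (x ∷ y ∷ ys) =
      trans (subsetᵇ-if (rel x y) (ascPos rel (suc i) (y ∷ ys)))
            (cong (_ ∧_) (subsetᵇ-ascPos (suc i) S (y ∷ ys)))
      where
      subsetᵇ-if : ∀ b R → subsetᵇ (if b then i ∷ R else R) S ≡ (not b ∨ elemᵇ i S) ∧ subsetᵇ R S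
      subsetᵇ-if true  R = refl
      subsetᵇ-if false R = refl

    ascentsWithin-[] : ∀ i xs → ascentsWithin i [] xs ≡ noAscent xs
    ascentsWithin-[] i []           = refl
    ascentsWithin-[] i (x ∷ [])     = refl
    ascentsWithin-[] i (x ∷ y ∷ ys) =
      cong₂ _∧_ (∨-identityʳ (not (rel x y))) (ascentsWithin-[] (suc i) (y ∷ ys))

    ascentsWithin-++ : ∀ i S y ys z zs j → j ≡ i + length ys → elemᵇ j S ≡ true →
      ascentsWithin i S (y ∷ ys ++ z ∷ zs) ≡ ascentsWithin i S (y ∷ ys) ∧ ascentsWithin (suc j) S (z ∷ zs)
    ascentsWithin-++ i S y []        z zs j j≡ j∈S = cong₂ _∧_
      (trans (cong (λ p → not (rel y z) ∨ elemᵇ p S) i≡j) (trans (cong (not (rel y z) ∨_) j∈S) (∨-zeroʳ _)))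
      (cong (λ p → ascentsWithin (suc p) S (z ∷ zs)) i≡j)
      where
      i≡j : i ≡ j
      i≡j = sym (trans j≡ (ℕ.+-identityʳ i))
    ascentsWithin-++ i S y (y′ ∷ ys) z zs j j≡ j∈S =
      trans (cong (_ ∧_) (ascentsWithin-++ (suc i) S y′ ys z zs j (trans j≡ (ℕ.+-suc i (length ys))) j∈S))
            (sym (∧-assoc (not (rel y y′) ∨ elemᵇ i S) _ _))

    ascentsWithin-cong : ∀ i S₁ S₂ xs →
      (∀ p → i ≤ p → suc p < i + length xs → elemᵇ p S₁ ≡ elemᵇ p S₂) →
      ascentsWithin i S₁ xs ≡ ascentsWithin i S₂ xs
    ascentsWithin-cong i S₁ S₂ []           _ = refl
    ascentsWithin-cong i S₁ S₂ (x ∷ [])     _ = refl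
    ascentsWithin-cong i S₁ S₂ (x ∷ y ∷ ys) h = cong₂ _∧_
      (cong (not (rel x y) ∨_) (h i ℕ.≤-refl (shift (s≤s (ℕ.m<m+n i (s≤s z≤n))))))
      (ascentsWithin-cong (suc i) S₁ S₂ (y ∷ ys) (λ p i<p p< → h p (ℕ.≤-trans (ℕ.n≤1+n i) i<p) (shift p<)))
      where
      shift : ∀ {a} → a ≤ suc i + suc (length ys) → a ≤ i + suc (suc (length ys))
      shift {a} = subst (a ≤_) (sym (ℕ.+-suc i (suc (length ys))))

    module Blocks (n k : ℕ) (D : ℕ → ℕ) (desc-card : ∀ L → Sat (Desc k L) ↔ Fin (D L)) where

      -- The part of a word after position prev, whose ascents must lie in S (positions are absolute).
      Block : ℕ → List ℕ → List ℕ → Bool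
      Block prev S xs = (length xs ≡ᵇ n ∸ prev) ∧ all (inRange k) xs ∧ ascentsWithin (suc prev) S xs

      record IsBlock (prev : ℕ) (S xs : List ℕ) : Set where
        constructor block
        field
          length≡ : length xs ≡ n ∸ prev
          values  : T (all (inRange k) xs)
          ascents : T (ascentsWithin (suc prev) S xs)

      isBlock : ∀ prev S xs → T (Block prev S xs) → IsBlock prev S xs
      isBlock prev S xs p = block (≡ᵇ⇒≡ _ _ (∧-fst p)) (∧-fst q) (∧-snd {all (inRange k) xs} q)
        where q = ∧-snd {length xs ≡ᵇ n ∸ prev} p

      Block-intro : ∀ prev S xs → IsBlock prev S xs → T (Block prev S xs)
      Block-intro prev S xs (block l v a) = ∧-intro (≡⇒≡ᵇ _ _ l) (∧-intro v a)

      gap-split : ∀ prev s → prev ≤ s → s ≤ n → (s ∸ prev) + (n ∸ s) ≡ n ∸ prev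
      gap-split prev s prev≤s s≤n = begin
        (s ∸ prev) + (n ∸ s)                   ≡⟨ cong ((s ∸ prev) +_) (sym remaining) ⟩
        (s ∸ prev) + ((n ∸ prev) ∸ (s ∸ prev)) ≡⟨ ℕ.m+[n∸m]≡n (ℕ.∸-monoˡ-≤ prev s≤n) ⟩
        n ∸ prev                               ∎
        where
        open ≡-Reasoning
        remaining : (n ∸ prev) ∸ (s ∸ prev) ≡ n ∸ s
        remaining = trans (ℕ.∸-+-assoc n prev (s ∸ prev)) (cong (n ∸_) (ℕ.m+[n∸m]≡n prev≤s))

      module _ {prev s : ℕ} {S : List ℕ} (prev<s : prev < s) (b : Between n s S) where

        private
          d = s ∸ prev

          s<n : s < n
          s<n = Between-< n s S b

          gaps-add : d + (n ∸ s) ≡ n ∸ prev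
          gaps-add = gap-split prev s (ℕ.<⇒≤ prev<s) (ℕ.<⇒≤ s<n)

          rest-nonempty : ∀ (zs : List ℕ) → length zs ≡ n ∸ s → 1 ≤ length zs
          rest-nonempty _ l = subst (1 ≤_) (sym l) (ℕ.m<n⇒0<n∸m s<n)

        first-gap : ∀ ys zs → length ys ≡ d → 1 ≤ length zs →
          ascentsWithin (suc prev) (s ∷ S) (ys ++ zs) ≡ noAscent ys ∧ ascentsWithin (suc s) S zs
        first-gap []       zs       l _ = ⊥-elim (ℕ.<-irrefl l (ℕ.m<n⇒0<n∸m prev<s))
        first-gap (y ∷ ys) (z ∷ zs) l _ =
          trans (ascentsWithin-++ (suc prev) (s ∷ S) y ys z zs s s≡ s∈)
                (cong₂ _∧_ (trans (ascentsWithin-cong (suc prev) (s ∷ S) [] (y ∷ ys) inside)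
                                  (ascentsWithin-[] (suc prev) (y ∷ ys)))
                           (ascentsWithin-cong (suc s) (s ∷ S) S (z ∷ zs) beyond))
          where
          s≡ : s ≡ suc prev + length ys
          s≡ = trans (sym (ℕ.m+[n∸m]≡n (ℕ.<⇒≤ prev<s)))
                     (trans (cong (prev +_) (sym l)) (ℕ.+-suc prev (length ys)))
          s∈ : elemᵇ s (s ∷ S) ≡ true
          s∈ = cong (_∨ elemᵇ s S) (T⇒≡true (≡⇒≡ᵇ s s refl))
          inside : ∀ p → suc prev ≤ p → suc p < suc prev + length (y ∷ ys) → elemᵇ p (s ∷ S) ≡ elemᵇ p []
          inside p _ p< =
            cong₂ _∨_ (T-not⇒≡false (≢⇒≢ᵇ p s (λ e → ℕ.<-irrefl e p<s))) (Between-∉ n s S b p (ℕ.<⇒≤ p<s))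
            where
            p<s : p < s
            p<s = subst (suc p ≤_) (trans (ℕ.+-suc prev (length ys)) (sym s≡)) (ℕ.≤-pred p<)
          beyond : ∀ p → suc s ≤ p → _ → elemᵇ p (s ∷ S) ≡ elemᵇ p S
          beyond p s<p _ = cong (_∨ elemᵇ p S) (T-not⇒≡false (≢⇒≢ᵇ p s (λ e → ℕ.<-irrefl (sym e) s<p)))

        Block-split : Sat (Block prev (s ∷ S)) ↔ Sat (λ (ys , zs) → Desc k d ys ∧ Block s S zs)
        Block-split = Sat-↔ (λ xs → take d xs , drop d xs) (λ (ys , zs) → ys ++ zs) split join
                            (λ xs _ → take++drop≡id d xs) split-join
          where
          split : ∀ xs → T (Block prev (s ∷ S) xs) → T (Desc k d (take d xs) ∧ Block s S (drop d xs))
          split xs p with isBlock prev (s ∷ S) xs p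
          ... | block l v a =
            ∧-intro (Desc-intro k d ys (desc lys (∧-fst vs) (∧-fst as)))
                    (Block-intro s S zs (block lzs (∧-snd {all (inRange k) ys} vs) (∧-snd {noAscent ys} as)))
            where
            ys = take d xs
            zs = drop d xs
            whole : ys ++ zs ≡ xs
            whole = take++drop≡id d xs
            lys : length ys ≡ d
            lys = trans (length-take d xs)
                        (ℕ.m≤n⇒m⊓n≡m (subst (d ≤_) (sym l) (ℕ.∸-monoˡ-≤ prev (ℕ.<⇒≤ s<n))))
            lzs : length zs ≡ n ∸ s
            lzs = trans (length-drop d xs) (trans (cong (_∸ d) (trans l (sym gaps-add))) (ℕ.m+n∸m≡n d (n ∸ s)))
            vs : T (all (inRange k) ys ∧ all (inRange k) zs)
            vs = T-subst (trans (cong (all (inRange k)) (sym whole)) (all-++ (inRange k) ys zs)) v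
            as : T (noAscent ys ∧ ascentsWithin (suc s) S zs)
            as = T-subst (trans (cong (ascentsWithin (suc prev) (s ∷ S)) (sym whole))
                                (first-gap ys zs lys (rest-nonempty zs lzs))) a

          join : ∀ ((ys , zs) : List ℕ × List ℕ) → T (Desc k d ys ∧ Block s S zs) →
            T (Block prev (s ∷ S) (ys ++ zs))
          join (ys , zs) p with isDesc k d ys (∧-fst p) | isBlock s S zs (∧-snd {Desc k d ys} p)
          ... | desc ly vy dy | block lz vz az = Block-intro prev (s ∷ S) (ys ++ zs) (block
            (trans (length-++ ys) (trans (cong₂ _+_ ly lz) gaps-add))
            (T-subst (sym (all-++ (inRange k) ys zs)) (∧-intro vy vz))
            (T-subst (sym (first-gap ys zs ly (rest-nonempty zs lz))) (∧-intro dy az)))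

          split-join : ∀ ((ys , zs) : List ℕ × List ℕ) → T (Desc k d ys ∧ Block s S zs) →
            (take d (ys ++ zs) , drop d (ys ++ zs)) ≡ (ys , zs)
          split-join (ys , zs) p = subst (λ d′ → (take d′ (ys ++ zs) , drop d′ (ys ++ zs)) ≡ (ys , zs))
            (IsDesc.length≡ (isDesc k d ys (∧-fst p))) (cong₂ _,_ (take-++ ys zs) (drop-++ ys zs))

      Block-card : ∀ prev S → Between n prev S → Sat (Block prev S) ↔ Fin (prodList (map D (gaps prev S n)))
      Block-card prev [] _ =
        ↔-trans (Sat-cong (λ xs → cong (λ a → (length xs ≡ᵇ n ∸ prev) ∧ all (inRange k) xs ∧ a)
                                       (ascentsWithin-[] (suc prev) xs)))
                (↔-trans (desc-card (n ∸ prev)) (Fin-cast (sym (ℕ.*-identityʳ _))))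
      Block-card prev (s ∷ S) (prev<s , b) =
        ↔-trans (Block-split prev<s b)
                (↔-trans (Sat-× (Desc k (s ∸ prev)) (Block s S))
                         (↔-trans (desc-card (s ∸ prev) ×-↔ Block-card s S b) (↔-sym *↔×)))


module CayleyCounting where

  open Subtypes
  open AlternatingSums
  open Relabelling
  open CayleyWords using (module WordFamily)
  open DescendingWords
  open AscentBlocks using (bracket⇒Between; module Segments)
  open import Defs
    using (elemᵇ; gaps; prodList; sumTo; valuesAreᵇ; Cay; CayAsc⊆; CayAscStrict⊆; IsSubsetOfBracket; multichoose)
  open import Data.Nat.Combinatorics using (_C_)
  open import Data.Bool using (Bool; true; _∧_; T)
  open import Data.Bool.Properties using (∧-identityʳ; T-∨; T-irrelevant)
  open import Data.Bool.ListAction using (all)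
  open import Data.Nat as ℕ using (ℕ; zero; suc; _≤_; _<_; _≥_; z≤n; s≤s; _≡ᵇ_; _≤ᵇ_; _<ᵇ_)
  open import Data.Nat.Properties as ℕ using (≡ᵇ⇒≡; ≡⇒≡ᵇ)
  open import Data.List using (List; []; _∷_; length; map; upTo; _++_)
  open import Data.List.Properties using (applyUpTo-∷ʳ; map-++)
  open import Data.Vec as Vec using (Vec; toList; lookup)
  open import Data.Vec.Properties using (length-toList)
  open import Data.Product using (Σ; _×_; _,_; proj₁; proj₂)
  open import Data.Sum using (inj₁; inj₂)
  open import Data.Fin as Fin using (Fin; toℕ)
  open import Data.Fin.Properties using (injective⇒≤; toℕ-injective; toℕ<n)
  open import Function.Bundles using (_↔_; mk↔ₛ′; Equivalence)
  open import Function.Properties.Inverse using (↔-trans)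
  open import Relation.Nullary using (yes; no)
  open import Relation.Binary.PropositionalEquality

  usesUpTo-spec : ∀ t xs → all (λ j → elemᵇ j xs) (map suc (upTo t)) ≡ usesUpTo t xs
  usesUpTo-spec zero    xs = refl
  usesUpTo-spec (suc t) xs = begin
    all present (map suc (upTo (suc t)))
      ≡⟨ cong (λ l → all present (map suc l)) (sym (applyUpTo-∷ʳ (λ i → i) t)) ⟩
    all present (map suc (upTo t ++ t ∷ []))
      ≡⟨ cong (all present) (map-++ suc (upTo t) (t ∷ [])) ⟩
    all present (map suc (upTo t) ++ suc t ∷ [])
      ≡⟨ all-++ present (map suc (upTo t)) (suc t ∷ []) ⟩
    all present (map suc (upTo t)) ∧ (elemᵇ (suc t) xs ∧ true)
      ≡⟨ cong₂ _∧_ (usesUpTo-spec t xs) (∧-identityʳ _) ⟩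
    usesUpTo (suc t) xs ∎
    where
    open ≡-Reasoning
    present : ℕ → Bool
    present j = elemᵇ j xs

  usesUpTo-elem : ∀ t xs → T (usesUpTo t xs) → ∀ j → 1 ≤ j → j ≤ t → T (elemᵇ j xs)
  usesUpTo-elem zero    xs p (suc j) (s≤s _) ()
  usesUpTo-elem (suc t) xs p j 1≤j j≤t with j ℕ.≟ suc t
  ... | yes refl = ∧-snd {usesUpTo t xs} p
  ... | no  j≢   = usesUpTo-elem t xs (∧-fst p) j 1≤j (ℕ.≤-pred (ℕ.≤∧≢⇒< j≤t j≢))

  position : ∀ {n} x (w : Vec ℕ n) → T (elemᵇ x (toList w)) → Σ (Fin n) λ i → lookup w i ≡ x
  position x (y Vec.∷ w) p with Equivalence.to T-∨ p
  ... | inj₁ x≡y = Fin.zero , sym (≡ᵇ⇒≡ x y x≡y)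
  ... | inj₂ x∈w with position x w x∈w
  ...   | i , e = Fin.suc i , e

  usesUpTo⇒≤length : ∀ {n} k (w : Vec ℕ n) → T (usesUpTo k (toList w)) → k ≤ n
  usesUpTo⇒≤length k w p = injective⇒≤ {f = occurrence} occurrence-injective
    where
    found : (i : Fin k) → Σ _ λ j → lookup w j ≡ suc (toℕ i)
    found i = position (suc (toℕ i)) w (usesUpTo-elem k (toList w) p (suc (toℕ i)) (s≤s z≤n) (toℕ<n i))
    occurrence : Fin k → Fin _
    occurrence i = proj₁ (found i)
    occurrence-injective : ∀ {i j} → occurrence i ≡ occurrence j → i ≡ j
    occurrence-injective {i} {j} e =
      toℕ-injective (ℕ.suc-injective
        (trans (sym (proj₂ (found i))) (trans (cong (lookup w) e) (proj₂ (found j)))))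

  fromList : (n : ℕ) → List ℕ → Vec ℕ n
  fromList zero    xs       = Vec.[]
  fromList (suc n) []       = 0 Vec.∷ fromList n []
  fromList (suc n) (x ∷ xs) = x Vec.∷ fromList n xs

  fromList-toList : ∀ {n} (w : Vec ℕ n) → fromList n (toList w) ≡ w
  fromList-toList Vec.[]       = refl
  fromList-toList (x Vec.∷ w) = cong (x Vec.∷_) (fromList-toList w)

  toList-fromList : ∀ n xs → length xs ≡ n → toList (fromList n xs) ≡ xs
  toList-fromList zero    []       _ = refl
  toList-fromList (suc n) (x ∷ xs) e = cong (x ∷_) (toList-fromList n xs (ℕ.suc-injective e))

  module CayleyCount (rel : ℕ → ℕ → Bool) (no-rel⇒≥ : NonAscent⇒≥ rel)
    (rel-squeeze : SqueezeInvariant rel)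
    (D : ℕ → ℕ → ℕ) (desc-card : ∀ k L → Sat (Descending.Desc rel no-rel⇒≥ k L) ↔ Fin (D k L))
    (n : ℕ) (n≥1 : n ≥ 1) (S : List ℕ) (S⊆[n-1] : IsSubsetOfBracket n S) where

    open WordFamily n S rel rel-squeeze
    open Segments rel no-rel⇒≥

    F : ℕ → ℕ
    F k = prodList (map (D k) (gaps 0 S n))

    Word-base : ∀ k → Sat (Word k 0) ↔ Fin (F k)
    Word-base k = ↔-trans (Sat-cong (λ xs → cong (λ a → (length xs ≡ᵇ n) ∧ all (inRange k) xs ∧ a)
                                            (trans (∧-identityʳ _) (subsetᵇ-ascPos 1 S xs))))
                          (Blocks.Block-card n k (D k) (desc-card k) 0 S (bracket⇒Between n n≥1 S S⊆[n-1]))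

    open InclusionExclusion (λ k t → Sat (Word k t)) F Word-base Word-split

    Labelled : ℕ × Vec ℕ n → Bool
    Labelled (k , w) = valuesAreᵇ k w ∧ ascentsIn (toList w)

    Cay↔Labelled : (Σ (Cay n) λ c → T (ascentsIn (toList (proj₁ (proj₂ c))))) ↔ Sat Labelled
    Cay↔Labelled = mk↔ₛ′ (λ ((k , w , v) , a) → (k , w) , ∧-intro v a)
                         (λ ((k , w) , p) → (k , w , ∧-fst p) , ∧-snd {valuesAreᵇ k w} p)
                         (λ _ → Sat-≡ refl)
                         (λ ((k , w , v) , a) →
                            cong₂ (λ v′ a′ → (k , w , v′) , a′) (T-irrelevant _ v) (T-irrelevant _ a))

    cayley-card : HasCard (Σ (Cay n) λ c → T (ascentsIn (toList (proj₁ (proj₂ c)))))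
                          (sumTo n (inclusionExclusion F))
    cayley-card = HasCard-↔ Cay↔Labelled
      (HasCard-≡ (sym (sumTo≡sumBelow n (inclusionExclusion F)))
                 (HasCard-fibres Labelled proj₁ (suc n) _ bound fibre))
      where
      uses : ∀ k w → T (valuesAreᵇ k w) → T (usesUpTo k (toList w))
      uses k w p = T-subst (usesUpTo-spec k (toList w)) (∧-snd {all (inRange k) (toList w)} p)

      bound : ∀ kw → T (Labelled kw) → proj₁ kw < suc n
      bound (k , w) p = s≤s (usesUpTo⇒≤length k w (uses k w (∧-fst p)))

      fibre : ∀ k → k < suc n → HasCard (Sat (λ kw → Labelled kw ∧ (proj₁ kw ≡ᵇ k))) (inclusionExclusion F k)
      fibre k _ = HasCard-↔ (Sat-↔ (λ (_ , w) → toList w) (λ xs → k , fromList n xs) forget label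
                                   unlabel-label (λ xs p → toList-fromList n xs (IsWord.length≡ (isWord k k xs p))))
                            (W-card-diagonal k)
        where
        unlabel-label : ∀ kw → T (Labelled kw ∧ (proj₁ kw ≡ᵇ k)) → (k , fromList n (toList (proj₂ kw))) ≡ kw
        unlabel-label (k′ , w) p = cong₂ _,_ (sym (≡ᵇ⇒≡ k′ k (∧-snd {Labelled (k′ , w)} p))) (fromList-toList w)
        forget : ∀ kw → T (Labelled kw ∧ (proj₁ kw ≡ᵇ k)) → T (Word k k (toList (proj₂ kw)))
        forget (k′ , w) p with ≡ᵇ⇒≡ k′ k (∧-snd {Labelled (k′ , w)} p)
        ... | refl = Word-intro k k (toList w)
          (word (length-toList w) (∧-fst (∧-fst l)) (∧-snd {valuesAreᵇ k w} l) (uses k w (∧-fst l)))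
          where l = ∧-fst p
        label : ∀ xs → T (Word k k xs) → T (Labelled (k , fromList n xs) ∧ (k ≡ᵇ k))
        label xs p with isWord k k xs p
        ... | word l v a u rewrite toList-fromList n xs l =
          ∧-intro (∧-intro (∧-intro v (T-subst (sym (usesUpTo-spec k xs)) u)) a) (≡⇒≡ᵇ k k refl)

  strict-ascents-card : ∀ n → n ≥ 1 → ∀ S → IsSubsetOfBracket n S →
    HasCard (CayAscStrict⊆ n S) (sumTo n (inclusionExclusion (λ j → prodList (map (multichoose j) (gaps 0 S n)))))
  strict-ascents-card = CayleyCount.cayley-card _<ᵇ_ not-<ᵇ⇒≥ squeeze-<ᵇ multichoose weakly-descending-card

  weak-ascents-card : ∀ n → n ≥ 1 → ∀ S → IsSubsetOfBracket n S →
    HasCard (CayAsc⊆ n S) (sumTo n (inclusionExclusion (λ j → prodList (map (j C_) (gaps 0 S n)))))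
  weak-ascents-card = CayleyCount.cayley-card _≤ᵇ_ not-≤ᵇ⇒≥ squeeze-≤ᵇ _C_ strictly-descending-card

open MatrixCounting using (matrices-card; binary-matrices-card)
open CayleyCounting using (strict-ascents-card; weak-ascents-card)
open import Defs
open import Data.Nat using (ℕ; _≥_; _*_; _∸_)
open import Data.Nat.Combinatorics using (_C_)
open import Data.List using (List; map)
open import Data.Integer using (+_) renaming (_*_ to _*ℤ_)
open import Data.Fin using (Fin)
open import Data.Product using (_×_; ∃; _,_)
open import Function.Bundles using (_↔_)
open import Relation.Binary.PropositionalEquality using (_≡_)

proposition5p1 :
    ((m n : ℕ) → ∃ λ N → (G m n ↔ Fin N) ×
      (+ N ≡ sumTo n (λ k → sumTo k (λ i →
         sign i *ℤ (+ (k C i)) *ℤ + multichoose (m * (k ∸ i)) n)))) ×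
    ((m n : ℕ) → ∃ λ N → (G01 m n ↔ Fin N) ×
      (+ N ≡ sumTo n (λ k → sumTo k (λ i →
         sign i *ℤ (+ (k C i)) *ℤ + ((m * (k ∸ i)) C n))))) ×
    ((n : ℕ) → n ≥ 1 → (S : List ℕ) → IsSubsetOfBracket n S →
      ∃ λ N → (CayAscStrict⊆ n S ↔ Fin N) ×
      (+ N ≡ sumTo n (λ k → sumTo k (λ i →
         sign i *ℤ (+ (k C i)) *ℤ
           + prodList (map (multichoose (k ∸ i)) (gaps 0 S n)))))) ×
    ((n : ℕ) → n ≥ 1 → (S : List ℕ) → IsSubsetOfBracket n S →
      ∃ λ N → (CayAsc⊆ n S ↔ Fin N) ×
      (+ N ≡ sumTo n (λ k → sumTo k (λ i →
         sign i *ℤ (+ (k C i)) *ℤ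
           + prodList (map ((k ∸ i) C_) (gaps 0 S n))))))
proposition5p1 = matrices-card , binary-matrices-card , strict-ascents-card , weak-ascents-card
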